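{- Fix a partition $\lambda$. The uncrowding map $T\mapsto (T^+,x,i_0)$, where $T^+$ is the uncrowding of $T$, $x$ is the unique cell of the shape of $T^+$ not in $\lambda$, and $i_0$ is the row index of the unique cell $x_0$ of $T$ with $\#T(x_0)=2$, is a bijection from the set of column-strict barely set-valued tableaux of shape $\lambda$ onto the set of triples $(U,x,i_0)$ such that $U$ is a column-strict tableau whose shape $\lambda^+$ satisfies $\lambda\lessdot\lambda^+$ with $\lambda^+\setminus\lambda=\{x\}$ (so $x$ is an inner corner cell of $\lambda^+$), and $1\le i_0\le i-1$ where $i$ is the row index of $x$.
   Context: A column-strict set-valued tableau of shape $\lambda$ assigns to each cell $x$ of the Ferrers diagram (English notation, rows indexed from the top) a finite nonempty set $T(x)$ of positive integers such that $\max T(x)\le\min T(x')$ when $x$ is left of $x'$ in the same row and $\max T(x)<\min T(x')$ when $x$ is above $x'$ in the same column. It is a column-strict tableau if every $\#T(x)=1$, and barely set-valued if $\#T(x)=1$ for all cells except one cell $x_0$ with $\#T(x_0)=2$. Uncrowding: given a column-strict barely set-valued tableau $T$ with $T(x_0)=\{a_0<b_0\}$, $x_0$ in row $i_0$, remove $b_0$ from $x_0$ and RSK row-insert $b_0$ into the rows strictly below row $i_0$: starting with $v=b_0$ in row $r=i_0+1$, if row $r$ has an entry strictly greater than $v$, replace the leftmost such entry by $v$, let $v$ be the replaced entry and move to row $r+1$; otherwise append $v$ at the end of row $r$ (possibly an empty row) and stop. The result is the column-strict tableau $T^+$. -}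

module Defs where

open import Data.Nat using (ℕ; zero; suc; _≤_; _<_; _≥_; _∸_; _≡ᵇ_)
open import Data.Bool using (true; false; if_then_else_)
open import Data.List using (List; []; _∷_; map; length; [_])
open import Data.List.Relation.Unary.All using (All)
open import Data.List.Relation.Unary.AllPairs using (AllPairs)
open import Data.List.Membership.Propositional using (_∈_)
open import Data.Maybe using (Maybe; just; nothing)
open import Data.Product using (Σ; ∃; _×_; _,_; proj₁; proj₂)
open import Data.Sum using (_⊎_)
open import Relation.Binary.PropositionalEquality using (_≡_; _≢_)
open import Relation.Nullary using (¬_)
open import Function.Bundles using (_⇔_)

-- Conventions
--  * A partition is a list of positive, weakly decreasing parts.
--  * A (set-valued) tableau is a list of rows (top to bottom, English
--    notation); each row is a list of cells (left to right); each cell is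
--    a finite set of positive integers, represented canonically as a
--    strictly increasing list of naturals.
--  * A column-strict tableau (one entry per cell) is a List (List ℕ).
--  * Rows and columns are indexed from 1.

at : {A : Set} → List A → ℕ → Maybe A
at []       _             = nothing
at (x ∷ xs) zero          = nothing
at (x ∷ xs) (suc zero)    = just x
at (x ∷ xs) (suc (suc n)) = at xs (suc n)

cell : List (List (List ℕ)) → ℕ → ℕ → Maybe (List ℕ)
cell T r c with at T r
... | nothing  = nothing
... | just row = at row c

Partition : List ℕ → Set
Partition lam = All (1 ≤_) lam × AllPairs _≥_ lam

part : List ℕ → ℕ → ℕ
part lam r with at lam r
... | nothing = 0
... | just k  = k

InShape : List ℕ → ℕ × ℕ → Set
InShape lam (r , c) = 1 ≤ r × 1 ≤ c × c ≤ part lam r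

Covers : List ℕ → List ℕ → ℕ × ℕ → Set
Covers lam mu x =
  Partition mu ×
  ¬ InShape lam x ×
  (∀ y → InShape mu y ⇔ (InShape lam y ⊎ y ≡ x))

SetValuedTableau : List ℕ → List (List (List ℕ)) → Set
SetValuedTableau lam T =
  map length T ≡ lam ×
  (∀ r c s → cell T r c ≡ just s → (s ≢ []) × AllPairs _<_ s × All (1 ≤_) s) ×
  (∀ r c c' s s' → c < c' → cell T r c ≡ just s → cell T r c' ≡ just s' →
     ∀ a b → a ∈ s → b ∈ s' → a ≤ b) ×
  (∀ r r' c s s' → r < r' → cell T r c ≡ just s → cell T r' c ≡ just s' →
     ∀ a b → a ∈ s → b ∈ s' → a < b)

BarelySetValued : List ℕ → List (List (List ℕ)) → Set
BarelySetValued lam T =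
  SetValuedTableau lam T ×
  Σ (ℕ × ℕ) λ x0 →
    (Σ (List ℕ) λ s → cell T (proj₁ x0) (proj₂ x0) ≡ just s × length s ≡ 2) ×
    (∀ r c s → cell T r c ≡ just s → (r , c) ≢ x0 → length s ≡ 1)

ColumnStrictTableau : List ℕ → List (List ℕ) → Set
ColumnStrictTableau lam U = SetValuedTableau lam (map (map [_]) U)

-- insert v into a row: replace the leftmost entry strictly greater than v,
-- returning the bumped entry (nothing = v was appended at the end)
insertRow : ℕ → List ℕ → Maybe ℕ × List ℕ
insertRow v []       = nothing , [ v ]
insertRow v (w ∷ ws) with suc v Data.Nat.≤ᵇ w
... | true  = just w , v ∷ ws
... | false with insertRow v ws
...   | (m , ws') = m , w ∷ ws'

insertRows : ℕ → List (List ℕ) → List (List ℕ)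
insertRows v []           = [ [ v ] ]
insertRows v (row ∷ rest) with insertRow v row
... | nothing , row' = row' ∷ rest
... | just w  , row' = row' ∷ insertRows w rest

-- min of a cell (its first element, in canonical form)
headOr : List ℕ → ℕ
headOr []      = 0
headOr (a ∷ _) = a

secondInRow : List (List ℕ) → Maybe ℕ
secondInRow []                  = nothing
secondInRow ((a ∷ b ∷ _) ∷ _)   = just b
secondInRow (_ ∷ cs)            = secondInRow cs

-- process rows, i = index of the current row; returns T⁺ and i₀
uncrowdRows : List (List (List ℕ)) → ℕ → List (List ℕ) × ℕ
uncrowdRows []           i = [] , 0
uncrowdRows (row ∷ rest) i with secondInRow row
... | just b  = map headOr row ∷ insertRows b (map (map headOr) rest) , i
... | nothing with uncrowdRows rest (suc i)
...   | (U , i0) = map headOr row ∷ U , i0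

newCell : List ℕ → List ℕ → ℕ → ℕ × ℕ
newCell lam      []       r = 0 , 0
newCell []       (m ∷ _)  r = r , m
newCell (l ∷ ls) (m ∷ ms) r = if l ≡ᵇ m then newCell ls ms (suc r) else (r , m)

uncrowd : List ℕ → List (List (List ℕ)) → List (List ℕ) × (ℕ × ℕ) × ℕ
uncrowd lam T with uncrowdRows T 1
... | (U , i0) = U , newCell lam (map length U) 1 , i0

Target : List ℕ → List (List ℕ) × (ℕ × ℕ) × ℕ → Set
Target lam (U , x , i0) =
  ColumnStrictTableau (map length U) U ×
  Covers lam (map length U) x ×
  1 ≤ i0 × i0 ≤ proj₁ x ∸ 1

-- A barely set-valued tableau T consists of column-strict rows A above row i₀,
-- a row L {a , b} R, and rows B below.  Removing b from the doubled cell and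
-- inserting it into B is the same as RSK-inserting a into the column-strict
-- tableau with rows L b R and B, where a bumps b.  Hence T⁺ is column strict
-- and its shape gains one cell, strictly below row i₀.  Conversely, for
-- (U , x , i₀), reverse bumping from the corner x up to row i₀ + 1 expels an
-- entry v, which doubles the rightmost cell of row i₀ with an entry below v.
-- Reverse bumping inverts row insertion step by step, which gives both
-- injectivity and surjectivity.
module Submission where

open import Defs
open import Data.Nat
open import Data.Nat.Properties
open import Data.Bool using (true; false; if_then_else_)
open import Data.List
open import Data.List.Properties using (∷-injective; length-map)
open import Data.List.Relation.Unary.All using (All; []; _∷_) renaming (map to allMap)
open import Data.List.Relation.Unary.All.Properties using (++⁺; ++⁻ˡ; ++⁻ʳ; map⁺; map⁻)
open import Data.List.Relation.Unary.AllPairs using (AllPairs; []; _∷_)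
open import Data.List.Relation.Unary.Linked using (Linked; []; [-]; _∷_) renaming (tail to Linked-tail; map to Linked-map)
open import Data.List.Relation.Unary.Linked.Properties
  using (Linked⇒All; Linked⇒AllPairs; AllPairs⇒Linked) renaming (map⁺ to Linked-map⁺; map⁻ to Linked-map⁻)
open import Data.List.Membership.Propositional using (_∈_)
open import Data.List.Relation.Unary.Any using (here; there)
open import Data.Maybe using (Maybe; just; nothing)
open import Data.Maybe.Properties using (just-injective)
open import Data.Product hiding (map)
open import Data.Unit using (⊤; tt)
open import Data.Empty
open import Data.Sum using (_⊎_; inj₁; inj₂)
open import Relation.Binary.PropositionalEquality hiding ([_])
open import Relation.Nullary using (yes; no; ¬_)
open import Function.Bundles using (mk⇔; Equivalence)
open import Function.Base using (case_of_; flip; _∘_)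

≤ᵇ≡true⇒≤ : ∀ {m n} → (m ≤ᵇ n) ≡ true → m ≤ n
≤ᵇ≡true⇒≤ {m} {n} e = ≤ᵇ⇒≤ m n (subst Data.Bool.T (sym e) _)

≤⇒≤ᵇ≡true : ∀ {m n} → m ≤ n → (m ≤ᵇ n) ≡ true
≤⇒≤ᵇ≡true {m} {n} p with m ≤ᵇ n | ≤⇒≤ᵇ p
... | true | _ = refl

≤ᵇ≡false⇒> : ∀ {m n} → (m ≤ᵇ n) ≡ false → n < m
≤ᵇ≡false⇒> e = ≰⇒> (λ p → case (trans (sym (≤⇒≤ᵇ≡true p)) e) of λ ())

>⇒≤ᵇ≡false : ∀ {m n} → n < m → (m ≤ᵇ n) ≡ false
>⇒≤ᵇ≡false {m} {n} p with m ≤ᵇ n in e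
... | true = ⊥-elim (<⇒≱ p (≤ᵇ≡true⇒≤ e))
... | false = refl

≤ᵇ≡false⇒≥ : ∀ {v r} → (suc v ≤ᵇ r) ≡ false → r ≤ v
≤ᵇ≡false⇒≥ e = ≤-pred (≤ᵇ≡false⇒> e)

≤∸1⇒+suc : ∀ n i → 1 ≤ n → n ≤ i ∸ 1 → Σ ℕ λ j → i ≡ n + suc j
≤∸1⇒+suc (suc m) zero p ()
≤∸1⇒+suc n (suc i') p q = i' ∸ n , trans (cong suc (sym (m+[n∸m]≡n q))) (sym (+-suc n (i' ∸ n)))

n≢n+suc : ∀ n i → n ≢ n + suc i
n≢n+suc n i e = m+1+n≢m n (sym e)

length-∷ʳ : ∀ (S : List ℕ) v → length (S ++ [ v ]) ≡ suc (length S)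
length-∷ʳ [] v = refl
length-∷ʳ (x ∷ S) v = cong suc (length-∷ʳ S v)

++-∷-cancel : ∀ {A : Set} (X X' : List A) y y' Y Y' → length X ≡ length X' → X ++ y ∷ Y ≡ X' ++ y' ∷ Y' →
  X ≡ X' × y ≡ y' × Y ≡ Y'
++-∷-cancel [] [] y y' Y Y' l refl = refl , refl , refl
++-∷-cancel (x ∷ X) (x' ∷ X') y y' Y Y' l e with ++-∷-cancel X X' y y' Y Y' (suc-injective l) (proj₂ (∷-injective e))
... | e1 , e2 , e3 = cong₂ _∷_ (proj₁ (∷-injective e)) e1 , e2 , e3

All-split : ∀ {A : Set} {P : A → Set} X y Y → All P (X ++ y ∷ Y) → All P X × P y × All P Y
All-split X y Y a with ++⁻ʳ X a
... | p ∷ q = ++⁻ˡ X a , p , q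

All-join : ∀ {A : Set} {P : A → Set} {X y Y} → All P X → P y → All P Y → All P (X ++ y ∷ Y)
All-join a p q = ++⁺ a (p ∷ q)

AllPairs-suffix : ∀ (X : List ℕ) {Y} → AllPairs _≥_ (X ++ Y) → AllPairs _≥_ Y
AllPairs-suffix [] p = p
AllPairs-suffix (x ∷ X) (_ ∷ p) = AllPairs-suffix X p

at-0 : ∀ {A : Set} (xs : List A) {x} → at xs 0 ≢ just x
at-0 [] ()
at-0 (_ ∷ _) ()

All-at : ∀ {A : Set} {P : A → Set} {xs} i {x} → All P xs → at xs i ≡ just x → P x
All-at {xs = []} i a ()
All-at {xs = y ∷ xs} zero a ()
All-at {xs = y ∷ xs} (suc zero) (p ∷ a) refl = p
All-at {xs = y ∷ xs} (suc (suc i)) (p ∷ a) e = All-at (suc i) a e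

at-All : ∀ {A : Set} {P : A → Set} xs → (∀ i x → at xs i ≡ just x → P x) → All P xs
at-All [] h = []
at-All (x ∷ xs) h = h 1 x refl ∷ at-All xs f
  where
  f : ∀ i y → at xs i ≡ just y → _
  f zero y e = ⊥-elim (at-0 xs e)
  f (suc i) y e = h (suc (suc i)) y e

at-All′ : ∀ {A : Set} {P : A → Set} xs → (∀ i x → at xs (suc i) ≡ just x → P x) → All P xs
at-All′ xs h = at-All xs f
  where
  f : ∀ i x → at xs i ≡ just x → _
  f zero x e = ⊥-elim (at-0 xs e)
  f (suc i) x e = h i x e

at-Linked : ∀ {A : Set} {R : A → A → Set} xs →
  (∀ i x y → at xs (suc i) ≡ just x → at xs (suc (suc i)) ≡ just y → R x y) → Linked R xs
at-Linked [] h = []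
at-Linked (x ∷ []) h = [-]
at-Linked (x ∷ y ∷ xs) h = h 0 x y refl refl ∷ (at-Linked (y ∷ xs) (λ i a b e1 e2 → h (suc i) a b e1 e2))

at-map : ∀ {A B : Set} (f : A → B) xs i {x} → at xs i ≡ just x → at (map f xs) i ≡ just (f x)
at-map f [] i ()
at-map f (y ∷ xs) zero ()
at-map f (y ∷ xs) (suc zero) refl = refl
at-map f (y ∷ xs) (suc (suc i)) e = at-map f xs (suc i) e

at-++ˡ : ∀ {A : Set} (X Z : List A) i {x} → at X i ≡ just x → at (X ++ Z) i ≡ just x
at-++ˡ [] Z i ()
at-++ˡ (y ∷ X) Z zero ()
at-++ˡ (y ∷ X) Z (suc zero) e = e
at-++ˡ (y ∷ X) Z (suc (suc i)) e = at-++ˡ X Z (suc i) e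

at⇒≤length : ∀ {A : Set} (X : List A) i {x} → at X i ≡ just x → i ≤ length X
at⇒≤length [] i ()
at⇒≤length (y ∷ X) zero ()
at⇒≤length (y ∷ X) (suc zero) e = s≤s z≤n
at⇒≤length (y ∷ X) (suc (suc i)) e = s≤s (at⇒≤length X (suc i) e)

at-middle : ∀ {A : Set} (X : List A) y Y → at (X ++ y ∷ Y) (suc (length X)) ≡ just y
at-middle [] y Y = refl
at-middle (x ∷ []) y Y = refl
at-middle (x ∷ x' ∷ X) y Y = at-middle (x' ∷ X) y Y

at-++ʳ : ∀ {A : Set} (X : List A) y Y i {z} → at Y (suc i) ≡ just z →
  at (X ++ y ∷ Y) (suc (length X) + suc i) ≡ just z
at-++ʳ [] y Y i e = e
at-++ʳ (x ∷ X) y Y i e = at-++ʳ X y Y i e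

at-++-∷-cases : ∀ {A : Set} (X : List A) y Y r {z} → at (X ++ y ∷ Y) r ≡ just z →
  at X r ≡ just z ⊎ (r ≡ suc (length X) × z ≡ y) ⊎ Σ ℕ (λ i → r ≡ suc (length X) + suc i × at Y (suc i) ≡ just z)
at-++-∷-cases X y Y zero e = ⊥-elim (at-0 (X ++ y ∷ Y) e)
at-++-∷-cases [] y Y (suc zero) refl = inj₂ (inj₁ (refl , refl))
at-++-∷-cases [] y Y (suc (suc i)) e = inj₂ (inj₂ (i , refl , e))
at-++-∷-cases (x ∷ X) y Y (suc zero) e = inj₁ e
at-++-∷-cases (x ∷ X) y Y (suc (suc r)) e with at-++-∷-cases X y Y (suc r) e
... | inj₁ e' = inj₁ e'
... | inj₂ (inj₁ (e1 , e2)) = inj₂ (inj₁ (cong suc e1 , e2))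
... | inj₂ (inj₂ (i , e1 , e2)) = inj₂ (inj₂ (i , cong suc e1 , e2))

at-split : ∀ {A : Set} (xs : List A) i {x} → at xs i ≡ just x →
  Σ (List A) λ X → Σ (List A) λ Y → xs ≡ X ++ x ∷ Y × suc (length X) ≡ i
at-split [] i ()
at-split (y ∷ xs) zero ()
at-split (y ∷ xs) (suc zero) refl = [] , xs , refl , refl
at-split (y ∷ xs) (suc (suc i)) e with at-split xs (suc i) e
... | X , Y , refl , e2 = y ∷ X , Y , refl , cong suc e2

at-exists : ∀ {A : Set} (xs : List A) i → 1 ≤ i → i ≤ length xs → Σ A λ x → at xs i ≡ just x
at-exists [] zero () q
at-exists [] (suc i) p ()
at-exists (x ∷ xs) zero () q
at-exists (x ∷ xs) (suc zero) p q = x , refl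
at-exists (x ∷ xs) (suc (suc i)) p (s≤s q) = at-exists xs (suc i) (s≤s z≤n) q

AllPairs-adjacent : ∀ {xs : List ℕ} i {x y} → AllPairs _≥_ xs → at xs (suc i) ≡ just x →
  at xs (suc (suc i)) ≡ just y → y ≤ x
AllPairs-adjacent {x0 ∷ x1 ∷ xs} zero (p ∷ _) refl refl with p
... | q ∷ _ = q
AllPairs-adjacent {x0 ∷ xs} (suc i) (_ ∷ a) e1 e2 = AllPairs-adjacent {xs} i a e1 e2

Head : {A : Set} → (A → Set) → List A → Set
Head P [] = ⊤
Head P (x ∷ _) = P x

Head-map : ∀ {A : Set} {P Q : A → Set} → (∀ {x} → P x → Q x) → ∀ xs → Head P xs → Head Q xs
Head-map f [] h = tt
Head-map f (x ∷ xs) h = f h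

HeadBelow : ℕ → List ℕ → Set
HeadBelow w [] = ⊥
HeadBelow w (s ∷ _) = s < w

Linked-∷ : ∀ {A : Set} {R : A → A → Set} {x xs} → Head (R x) xs → Linked R xs → Linked R (x ∷ xs)
Linked-∷ {xs = []} h l = [-]
Linked-∷ {xs = y ∷ xs} h l = h ∷ l

Linked-head : ∀ {A : Set} {R : A → A → Set} {x xs} → Linked R (x ∷ xs) → Head (R x) xs
Linked-head [-] = tt
Linked-head (r ∷ _) = r

Linked-replaceHead : ∀ {A : Set} {R : A → A → Set} {x y xs} →
  Linked R (x ∷ xs) → (Head (R x) xs → Head (R y) xs) → Linked R (y ∷ xs)
Linked-replaceHead l f = Linked-∷ (f (Linked-head l)) (Linked-tail l)

Linked-splice : ∀ {A : Set} {R : A → A → Set} (X : List A) y Y Y' → Linked R (X ++ y ∷ Y) →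
  Linked R (y ∷ Y') → Linked R (X ++ y ∷ Y')
Linked-splice [] y Y Y' l l' = l'
Linked-splice {R = R} (x ∷ X) y Y Y' l l' = Linked-∷ (hd X (Linked-head l)) (Linked-splice X y Y Y' (Linked-tail l) l')
  where
  hd : ∀ X → Head (R x) (X ++ y ∷ Y) → Head (R x) (X ++ y ∷ Y')
  hd [] h = h
  hd (_ ∷ _) h = h

Linked-suffix : ∀ {A : Set} {R : A → A → Set} (X : List A) y Y → Linked R (X ++ y ∷ Y) → Linked R (y ∷ Y)
Linked-suffix [] y Y l = l
Linked-suffix (x ∷ X) y Y l = Linked-suffix X y Y (Linked-tail l)

Linked-head-at : ∀ {A : Set} {P : A → Set} {R : A → A → Set} → (∀ {x y z} → P y → R x y → R y z → R x z) →
  ∀ {x0 xs} n {y} → All P xs → Linked R (x0 ∷ xs) → at xs (suc n) ≡ just y → R x0 y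
Linked-head-at tr {xs = x1 ∷ xs} zero a (r ∷ l) refl = r
Linked-head-at tr {xs = x1 ∷ xs} (suc n) (p ∷ a) (r ∷ l) e = tr p r (Linked-head-at tr n a l e)

Linked-at : ∀ {A : Set} {P : A → Set} {R : A → A → Set} → (∀ {x y z} → P y → R x y → R y z → R x z) →
  ∀ xs c c' {x y} → All P xs → Linked R xs → c < c' → at xs c ≡ just x → at xs c' ≡ just y → R x y
Linked-at tr [] c c' a l lt () e2
Linked-at tr (x0 ∷ xs) zero c' a l lt () e2
Linked-at tr (x0 ∷ xs) (suc zero) (suc (suc n)) (_ ∷ a) l lt refl e2 = Linked-head-at tr n a l e2
Linked-at tr (x0 ∷ xs) (suc (suc m)) (suc (suc n)) (_ ∷ a) l (s≤s lt) e1 e2 =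
  Linked-at tr xs (suc m) (suc n) a (Linked-tail l) lt e1 e2
Linked-at tr (x0 ∷ xs) (suc zero) (suc zero) a l (s≤s ()) e1 e2
Linked-at tr (x0 ∷ xs) (suc (suc m)) (suc zero) a l (s≤s ()) e1 e2
Linked-at tr (x0 ∷ xs) c zero a l () e1 e2

-- Atop R upper lower: lower is at most as long as upper, and R holds in each column.
data Atop {A : Set} (R : A → A → Set) : List A → List A → Set where
  [] : ∀ {u} → Atop R u []
  _∷_ : ∀ {x y u l} → R x y → Atop R u l → Atop R (x ∷ u) (y ∷ l)

Atop-∷ʳ : ∀ {A : Set} {R : A → A → Set} {X Y z} → Atop R X Y → Atop R (X ++ [ z ]) Y
Atop-∷ʳ [] = []
Atop-∷ʳ (r ∷ b) = r ∷ Atop-∷ʳ b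

Atop-length : ∀ {A : Set} {R : A → A → Set} {X Y} → Atop R X Y → length Y ≤ length X
Atop-length [] = z≤n
Atop-length (_ ∷ b) = s≤s (Atop-length b)

at-Atop : ∀ {A : Set} {S : A → A → Set} X Y → length Y ≤ length X →
  (∀ c s t → at X c ≡ just s → at Y c ≡ just t → S s t) → Atop S X Y
at-Atop X [] le h = []
at-Atop [] (y ∷ Y) () h
at-Atop (x ∷ X) (y ∷ Y) (s≤s le) h = h 1 x y refl refl ∷ at-Atop X Y le f
  where
  f : ∀ c s t → at X c ≡ just s → at Y c ≡ just t → _
  f zero s t e1 e2 = ⊥-elim (at-0 X e1)
  f (suc c) s t e1 e2 = h (suc (suc c)) s t e1 e2

Atop-at : ∀ {A : Set} {S : A → A → Set} {X Y} c {t} → Atop S X Y → at Y c ≡ just t → Σ A λ s →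
  at X c ≡ just s × S s t
Atop-at c [] ()
Atop-at zero (r ∷ b) ()
Atop-at (suc zero) (r ∷ b) refl = _ , refl , r
Atop-at (suc (suc c)) (r ∷ b) e = Atop-at (suc c) b e

column-first : ∀ {A : Set} {P : A → Set} {S : A → A → Set} → (∀ {x y z} → P y → S x y → S y z → S x z) →
  ∀ {X T} n {Y} c {s'} → All (All P) T → Linked (Atop S) (X ∷ T) → at T (suc n) ≡ just Y → at Y c ≡ just s' →
  Σ A λ s → at X c ≡ just s × S s s'
column-first tr {T = X1 ∷ T} zero c a (b ∷ l) refl e = Atop-at c b e
column-first tr {T = X1 ∷ T} (suc n) c (p ∷ a) (b ∷ l) e1 e2 with column-first tr n c a l e1 e2
... | t , et , st with Atop-at c b et
... | s , es , ss = s , es , tr (All-at c p et) ss st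

column-at : ∀ {A : Set} {P : A → Set} {S : A → A → Set} → (∀ {x y z} → P y → S x y → S y z → S x z) →
  ∀ T r r' {X Y} c {s'} → All (All P) T → Linked (Atop S) T → r < r' → at T r ≡ just X → at T r' ≡ just Y → at Y c ≡ just s' →
  Σ A λ s → at X c ≡ just s × S s s'
column-at tr [] r r' c a l lt () e2 e3
column-at tr (X0 ∷ T) zero r' c a l lt () e2 e3
column-at tr (X0 ∷ T) (suc zero) (suc (suc n)) c (_ ∷ a) l lt refl e2 e3 = column-first tr n c a l e2 e3
column-at tr (X0 ∷ T) (suc (suc m)) (suc (suc n)) c (_ ∷ a) l (s≤s lt) e1 e2 e3 =
  column-at tr T (suc m) (suc n) c a (Linked-tail l) lt e1 e2 e3
column-at tr (X0 ∷ T) (suc zero) (suc zero) c a l (s≤s ()) e1 e2 e3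
column-at tr (X0 ∷ T) (suc (suc m)) (suc zero) c a l (s≤s ()) e1 e2 e3
column-at tr (X0 ∷ T) r zero c a l () e1 e2 e3

Atop-map⁻ : ∀ {A B : Set} {R : B → B → Set} {S : A → A → Set} (f : A → B) → (∀ {x y} →
  R (f x) (f y) → S x y) →
  ∀ xs ys → Atop R (map f xs) (map f ys) → Atop S xs ys
Atop-map⁻ f h xs [] b = []
Atop-map⁻ f h [] (y ∷ ys) ()
Atop-map⁻ f h (x ∷ xs) (y ∷ ys) (r ∷ b) = h r ∷ Atop-map⁻ f h xs ys b

Atop-map⁺ : ∀ {A B : Set} {R : B → B → Set} {S : A → A → Set} (f : A → B) → (∀ {x y} → S x y →
  R (f x) (f y)) →
  ∀ xs ys → Atop S xs ys → Atop R (map f xs) (map f ys)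
Atop-map⁺ f h xs [] b = []
Atop-map⁺ f h [] (y ∷ ys) ()
Atop-map⁺ f h (x ∷ xs) (y ∷ ys) (r ∷ b) = h r ∷ Atop-map⁺ f h xs ys b

NonDecreasing : List ℕ → Set
NonDecreasing = Linked _≤_

StrictlyAtop : List ℕ → List ℕ → Set
StrictlyAtop = Atop _<_

head-≤-last : ∀ t S v → NonDecreasing (t ∷ S ++ [ v ]) → t ≤ v
head-≤-last t [] v (p ∷ _) = p
head-≤-last t (x ∷ S) v (p ∷ l) = ≤-trans p (head-≤-last x S v l)

≤-last : ∀ S v → NonDecreasing (S ++ [ v ]) → All (_≤ v) S
≤-last [] v l = []
≤-last (x ∷ S) v l = head-≤-last x S v l ∷ ≤-last S v (Linked-tail l)

nonDecreasing-init : ∀ S v → NonDecreasing (S ++ [ v ]) → NonDecreasing S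
nonDecreasing-init [] v l = []
nonDecreasing-init (x ∷ []) v l = [-]
nonDecreasing-init (x ∷ y ∷ S) v (p ∷ l) = p ∷ nonDecreasing-init (y ∷ S) v l

head-≤-middle : ∀ x L a R → NonDecreasing (x ∷ L ++ a ∷ R) → x ≤ a
head-≤-middle x [] a R l = Linked-head l
head-≤-middle x (y ∷ L) a R (p ∷ l) = ≤-trans p (head-≤-middle y L a R l)

≤-middle : ∀ L a R → NonDecreasing (L ++ a ∷ R) → All (_≤ a) L
≤-middle [] a R l = []
≤-middle (x ∷ L) a R l = head-≤-middle x L a R l ∷ ≤-middle L a R (Linked-tail l)

Head-≤-middle : ∀ L a R → NonDecreasing (L ++ a ∷ R) → Head (_≤ a) (L ++ a ∷ R)
Head-≤-middle [] a R l = ≤-refl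
Head-≤-middle (x ∷ L) a R l = head-≤-middle x L a R l

Head-≤-Head : ∀ {b a'} L a R → Head (b ≤_) (L ++ a ∷ R) → Head (_≤ a') (L ++ a ∷ R) → b ≤ a'
Head-≤-Head [] a R h h' = ≤-trans h h'
Head-≤-Head (x ∷ L) a R h h' = ≤-trans h h'

atop-first-<-last : ∀ r2 rs2 S1 v → StrictlyAtop (r2 ∷ rs2) (S1 ++ [ v ]) →
  NonDecreasing (S1 ++ [ v ]) → r2 < v
atop-first-<-last r2 rs2 [] v (p ∷ _) l = p
atop-first-<-last r2 rs2 (t ∷ S2) v (p ∷ _) l = <-≤-trans p (head-≤-last t S2 v l)

[]-not-atop : ∀ S1 v → StrictlyAtop [] (S1 ++ [ v ]) → ⊥
[]-not-atop [] v ()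
[]-not-atop (x ∷ S1) v ()

atop-init : ∀ X v Y → StrictlyAtop (X ++ [ v ]) Y → length Y ≤ length X → StrictlyAtop X Y
atop-init X v [] b le = []
atop-init [] v (y ∷ Y) b ()
atop-init (x ∷ X) v (y ∷ Y) (p ∷ b) (s≤s le) = p ∷ atop-init X v Y b le

atop-singleton : ∀ {w} X → X ≢ [] → Head (_< w) X → StrictlyAtop X (w ∷ [])
atop-singleton [] ne h = ⊥-elim (ne refl)
atop-singleton (x ∷ X) ne h = h ∷ []

atop-positive : ∀ X Y → StrictlyAtop X Y → All (1 ≤_) X → All (1 ≤_) Y
atop-positive X [] b a = []
atop-positive (x ∷ X) (y ∷ Y) (r ∷ b) (p ∷ a) = ≤-trans p (<⇒≤ r) ∷ atop-positive X Y b a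

positive-downward : ∀ X Ys → Linked StrictlyAtop (X ∷ Ys) → All (1 ≤_) X → All (All (1 ≤_)) Ys
positive-downward X [] l a = []
positive-downward X (Y ∷ Ys) (b ∷ l) a = atop-positive X Y b a ∷ positive-downward Y Ys l (atop-positive X Y b a)

NonEmpty : List ℕ → Set
NonEmpty S = S ≢ []

positive⇒nonEmpty : ∀ (X : List (List ℕ)) → All (1 ≤_) (map length X) → All NonEmpty X
positive⇒nonEmpty [] a = []
positive⇒nonEmpty ([] ∷ X) (() ∷ a)
positive⇒nonEmpty ((x ∷ r) ∷ X) (_ ∷ a) = (λ ()) ∷ positive⇒nonEmpty X a

nonEmpty⇒positive : ∀ (B : List (List ℕ)) → All NonEmpty B → All (1 ≤_) (map length B)
nonEmpty⇒positive [] a = []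
nonEmpty⇒positive ([] ∷ B) (n ∷ a) = ⊥-elim (n refl)
nonEmpty⇒positive ((x ∷ r) ∷ B) (n ∷ a) = s≤s z≤n ∷ nonEmpty⇒positive B a

shape-nonincreasing : ∀ U → Linked StrictlyAtop U → Linked _≥_ (map length U)
shape-nonincreasing [] l = []
shape-nonincreasing (X ∷ []) l = [-]
shape-nonincreasing (X ∷ Y ∷ U) (b ∷ l) = Atop-length b ∷ shape-nonincreasing (Y ∷ U) l

-- Row insertion

bumped : ℕ → List ℕ → Maybe ℕ
bumped v R = proj₁ (insertRow v R)

inserted : ℕ → List ℕ → List ℕ
inserted v R = proj₂ (insertRow v R)

inserted-nonempty : ∀ v R → inserted v R ≢ []
inserted-nonempty v [] ()
inserted-nonempty v (r ∷ rs) with suc v ≤ᵇ r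
... | true = λ ()
... | false = λ ()

Head-inserted : ∀ {P : ℕ → Set} v R → P v → Head P R → Head P (inserted v R)
Head-inserted v [] p h = p
Head-inserted v (r ∷ rs) p h with suc v ≤ᵇ r
... | true = p
... | false = h

inserted-nonDecreasing : ∀ v R → NonDecreasing R → NonDecreasing (inserted v R)
inserted-nonDecreasing v [] l = [-]
inserted-nonDecreasing v (r ∷ rs) l with suc v ≤ᵇ r in e
... | true = Linked-∷ (Head-map (≤-trans (<⇒≤ (≤ᵇ≡true⇒≤ e))) rs (Linked-head l)) (Linked-tail l)
... | false = Linked-∷ (Head-inserted v rs (≤ᵇ≡false⇒≥ e) (Linked-head l)) (inserted-nonDecreasing v rs (Linked-tail l))

<-bumped : ∀ v R w → bumped v R ≡ just w → v < w
<-bumped v [] w ()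
<-bumped v (r ∷ rs) w eq with suc v ≤ᵇ r in e
... | true = subst (v <_) (just-injective eq) (≤ᵇ≡true⇒≤ e)
... | false = <-bumped v rs w eq

Head-inserted-<-bumped : ∀ v R w → bumped v R ≡ just w → Head (_< w) (inserted v R)
Head-inserted-<-bumped v [] w ()
Head-inserted-<-bumped v (r ∷ rs) w eq with suc v ≤ᵇ r in e
... | true = subst (v <_) (just-injective eq) (≤ᵇ≡true⇒≤ e)
... | false = ≤-<-trans (≤ᵇ≡false⇒≥ e) (<-bumped v rs w eq)

inserted-atop : ∀ v rs ss w → StrictlyAtop rs ss → bumped v rs ≡ just w → StrictlyAtop (inserted v rs) ss
inserted-atop v [] ss w b ()
inserted-atop v (r ∷ rs) [] w b eq = []
inserted-atop v (r ∷ rs) (s ∷ ss) w (r<s ∷ b) eq with suc v ≤ᵇ r in e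
... | true = <-trans (≤ᵇ≡true⇒≤ e) r<s ∷ b
... | false = r<s ∷ inserted-atop v rs ss w b eq

inserted-appends : ∀ v R → bumped v R ≡ nothing → inserted v R ≡ R ++ [ v ]
inserted-appends v [] eq = refl
inserted-appends v (r ∷ rs) eq with suc v ≤ᵇ r
... | true = case eq of λ ()
... | false = cong (r ∷_) (inserted-appends v rs eq)

length-inserted : ∀ v R w → bumped v R ≡ just w → length (inserted v R) ≡ length R
length-inserted v [] w ()
length-inserted v (r ∷ rs) w eq with suc v ≤ᵇ r
... | true = refl
... | false = cong suc (length-inserted v rs w eq)

insertRow-≥-appends : ∀ v S → All (_≤ v) S → insertRow v S ≡ (nothing , S ++ [ v ])
insertRow-≥-appends v [] a = refl
insertRow-≥-appends v (s ∷ S) (p ∷ a)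
  rewrite >⇒≤ᵇ≡false {suc v} {s} (s≤s p) | insertRow-≥-appends v S a = refl

insertRow-splits : ∀ L a b R → All (_≤ a) L → a < b → insertRow a (L ++ b ∷ R) ≡ (just b , L ++ a ∷ R)
insertRow-splits [] a b R al ab rewrite ≤⇒≤ᵇ≡true ab = refl
insertRow-splits (x ∷ L) a b R (p ∷ al) ab rewrite >⇒≤ᵇ≡false {suc a} {x} (s≤s p) | insertRow-splits L a b R al ab = refl

-- The bumped entry w lands in the row below weakly left of where it left the
-- row above, which is what keeps the columns strict.
inserted-atop-inserted : ∀ v R S w → NonDecreasing R → StrictlyAtop R S → bumped v R ≡ just w →
  StrictlyAtop (inserted v R) (inserted w S)
inserted-atop-inserted v [] S w l b ()
inserted-atop-inserted v (r ∷ rs) S w l b eq with suc v ≤ᵇ r in e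
inserted-atop-inserted v (r ∷ rs) [] w l b refl | true = ≤ᵇ≡true⇒≤ e ∷ []
inserted-atop-inserted v (r ∷ rs) (s ∷ ss) w l (r<s ∷ b) refl | true
  rewrite ≤⇒≤ᵇ≡true r<s = ≤ᵇ≡true⇒≤ e ∷ b
inserted-atop-inserted v (r ∷ rs) [] w l b eq | false = ≤-<-trans (≤ᵇ≡false⇒≥ e) (<-bumped v rs w eq) ∷ []
inserted-atop-inserted v (r ∷ rs) (s ∷ ss) w l (r<s ∷ b) eq | false with suc w ≤ᵇ s
... | true = ≤-<-trans (≤ᵇ≡false⇒≥ e) (<-bumped v rs w eq) ∷ inserted-atop v rs ss w b eq
... | false = r<s ∷ inserted-atop-inserted v rs ss w (Linked-tail l) b eq

insertRows-stop : ∀ v S rest S' → insertRow v S ≡ (nothing , S') → insertRows v (S ∷ rest) ≡ S' ∷ rest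
insertRows-stop v S rest S' e rewrite e = refl

insertRows-bump : ∀ v S rest w S' → insertRow v S ≡ (just w , S') →
  insertRows v (S ∷ rest) ≡ S' ∷ insertRows w rest
insertRows-bump v S rest w S' e rewrite e = refl

insertRows-semistandard : ∀ B R v w → NonDecreasing R → All NonDecreasing B → Linked StrictlyAtop (R ∷ B) →
  bumped v R ≡ just w → All NonDecreasing (insertRows w B) × Linked StrictlyAtop (inserted v R ∷ insertRows w B)
insertRows-semistandard [] R v w iR aB lB eq = [-] ∷ [] , inserted-atop-inserted v R [] w iR [] eq ∷ [-]
insertRows-semistandard (S ∷ B) R v w iR (iS ∷ aB) (bRS ∷ lSB) eq with insertRow w S in e
... | nothing , S' = iS' ∷ aB , bRS' ∷ subst (λ X → Linked StrictlyAtop (X ∷ B)) S'≡S∷ʳw (Linked-replaceHead lSB (Head-map Atop-∷ʳ B))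
  where
  iS' = subst NonDecreasing (cong proj₂ e) (inserted-nonDecreasing w S iS)
  bRS' = subst (StrictlyAtop (inserted v R)) (cong proj₂ e) (inserted-atop-inserted v R S w iR bRS eq)
  S'≡S∷ʳw = trans (sym (inserted-appends w S (cong proj₁ e))) (cong proj₂ e)
... | just w' , S' with insertRows-semistandard B S w w' iS aB lSB (cong proj₁ e)
... | aB' , lB' = iS' ∷ aB' , bRS' ∷ subst (λ X → Linked StrictlyAtop (X ∷ insertRows w' B)) (cong proj₂ e) lB'
  where
  iS' = subst NonDecreasing (cong proj₂ e) (inserted-nonDecreasing w S iS)
  bRS' = subst (StrictlyAtop (inserted v R)) (cong proj₂ e) (inserted-atop-inserted v R S w iR bRS eq)

-- CellAdded lam mu k c: mu is lam plus the cell in row k, column c (both from 1).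
data CellAdded : List ℕ → List ℕ → ℕ → ℕ → Set where
  add-new : CellAdded [] (1 ∷ []) 1 1
  add-here : ∀ {l ls} → CellAdded (l ∷ ls) (suc l ∷ ls) 1 (suc l)
  add-there : ∀ {l ls ms k c} → CellAdded ls ms k c → CellAdded (l ∷ ls) (l ∷ ms) (suc k) c

¬cellAdded-row0 : ∀ {l m c} → CellAdded l m 0 c → ⊥
¬cellAdded-row0 ()

cellAdded-row-suc : ∀ {l m k c} → CellAdded l m k c → Σ ℕ λ k' → k ≡ suc k'
cellAdded-row-suc add-new = 0 , refl
cellAdded-row-suc add-here = 0 , refl
cellAdded-row-suc (add-there {k = k} g) = k , refl

cellAdded-row-positive : ∀ {l m k c} → CellAdded l m k c → 1 ≤ k
cellAdded-row-positive g with cellAdded-row-suc g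
... | k' , refl = s≤s z≤n

cellAdded-row1 : ∀ {lB m ms c} → CellAdded lB (m ∷ ms) 1 c →
     (lB ≡ [] × m ≡ 1 × ms ≡ [] × c ≡ 1) ⊎ (Σ ℕ λ l → lB ≡ l ∷ ms × m ≡ suc l × c ≡ suc l)
cellAdded-row1 add-new = inj₁ (refl , refl , refl , refl)
cellAdded-row1 add-here = inj₂ (_ , refl , refl , refl)
cellAdded-row1 (add-there g) = ⊥-elim (¬cellAdded-row0 g)

cellAdded-row≥2 : ∀ {lB m ms k c} → CellAdded lB (m ∷ ms) (suc (suc k)) c → Σ (List ℕ) λ lB' →
  lB ≡ m ∷ lB' × CellAdded lB' ms (suc k) c
cellAdded-row≥2 (add-there g) = _ , refl , g

cellAdded-positive : ∀ {l m k c} → CellAdded l m k c → All (1 ≤_) l → All (1 ≤_) m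
cellAdded-positive add-new a = s≤s z≤n ∷ []
cellAdded-positive add-here (p ∷ a) = s≤s z≤n ∷ a
cellAdded-positive (add-there g) (p ∷ a) = p ∷ cellAdded-positive g a

cellAdded-row≤length : ∀ {l m k c} → CellAdded l m k c → k ≤ length m
cellAdded-row≤length add-new = s≤s z≤n
cellAdded-row≤length add-here = s≤s z≤n
cellAdded-row≤length (add-there g) = s≤s (cellAdded-row≤length g)

cellAdded-prefix : ∀ (A : List (List ℕ)) (ρ : List ℕ) {l m k c} → CellAdded l m k c →
  CellAdded (map length A ++ length ρ ∷ l) (map length A ++ length ρ ∷ m) (suc (length A) + k) c
cellAdded-prefix [] ρ g = add-there g
cellAdded-prefix (X ∷ A) ρ g = add-there (cellAdded-prefix A ρ g)

cellAdded-split : ∀ (A : List (List ℕ)) (ρ : List ℕ) (Q : List (List ℕ)) {lam k c} →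
  CellAdded lam (map length A ++ length ρ ∷ map length Q) (suc (length A) + suc k) c →
  Σ (List ℕ) λ lamB → lam ≡ map length A ++ length ρ ∷ lamB × CellAdded lamB (map length Q) (suc k) c
cellAdded-split [] ρ Q g with cellAdded-row≥2 g
... | lB , refl , g' = lB , refl , g'
cellAdded-split (X ∷ A) ρ Q g with cellAdded-row≥2 g
... | l' , refl , g' with cellAdded-split A ρ Q g'
... | lB , refl , g'' = lB , refl , g''

-- Positivity rules out a zero-length row that the new cell could extend.
cellAdded-base-unique : ∀ {l1 l2 mu k c} → CellAdded l1 mu k c → CellAdded l2 mu k c →
  All (1 ≤_) l1 → All (1 ≤_) l2 → l1 ≡ l2
cellAdded-base-unique add-new add-new a1 a2 = refl
cellAdded-base-unique add-new add-here a1 (() ∷ _)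
cellAdded-base-unique add-here add-new (() ∷ _) a2
cellAdded-base-unique add-here add-here a1 a2 = refl
cellAdded-base-unique add-here (add-there g) a1 a2 = ⊥-elim (¬cellAdded-row0 g)
cellAdded-base-unique (add-there g) add-here a1 a2 = ⊥-elim (¬cellAdded-row0 g)
cellAdded-base-unique (add-there g) (add-there g') (_ ∷ a1) (_ ∷ a2) = cong (_ ∷_) (cellAdded-base-unique g g' a1 a2)

≡ᵇ-refl : ∀ n → (n ≡ᵇ n) ≡ true
≡ᵇ-refl zero = refl
≡ᵇ-refl (suc n) = ≡ᵇ-refl n

n≡ᵇ1+n≡false : ∀ n → (n ≡ᵇ suc n) ≡ false
n≡ᵇ1+n≡false zero = refl
n≡ᵇ1+n≡false (suc n) = n≡ᵇ1+n≡false n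

newCell-cellAdded : ∀ {lam mu k c} → CellAdded lam mu k c → ∀ r → newCell lam mu (suc r) ≡ (k + r , c)
newCell-cellAdded add-new r = refl
newCell-cellAdded (add-here {l}) r rewrite n≡ᵇ1+n≡false l = refl
newCell-cellAdded (add-there {l} {k = k} {c = c} g) r rewrite ≡ᵇ-refl l = trans (newCell-cellAdded g (suc r)) (cong (_, c) (+-suc k r))

newCell-cellAdded₁ : ∀ {lam mu k c} → CellAdded lam mu k c → newCell lam mu 1 ≡ (k , c)
newCell-cellAdded₁ {k = k} {c} g = trans (newCell-cellAdded g 0) (cong (_, c) (+-identityʳ k))

part-0 : ∀ l → part l 0 ≡ 0
part-0 [] = refl
part-0 (x ∷ l) = refl

part-injective : ∀ l m → All (1 ≤_) l → All (1 ≤_) m → (∀ r → part l r ≡ part m r) → l ≡ m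
part-injective [] [] _ _ h = refl
part-injective [] (m ∷ ms) _ (p ∷ _) h = ⊥-elim (<⇒≢ p (h 1))
part-injective (l ∷ ls) [] (p ∷ _) _ h = ⊥-elim (<⇒≢ p (sym (h 1)))
part-injective (l ∷ ls) (m ∷ ms) (_ ∷ a) (_ ∷ b) h =
  cong₂ _∷_ (h 1) (part-injective ls ms a b f)
  where
  f : ∀ r → part ls r ≡ part ms r
  f zero = trans (part-0 ls) (sym (part-0 ms))
  f (suc r) = h (suc (suc r))

OneCellMore : List ℕ → List ℕ → ℕ → ℕ → Set
OneCellMore lam mu k c = part mu k ≡ c × suc (part lam k) ≡ c × (∀ r → r ≢ k → part mu r ≡ part lam r)

cellAdded⇒oneCellMore : ∀ {lam mu k c} → CellAdded lam mu k c → OneCellMore lam mu k c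
cellAdded⇒oneCellMore add-new = refl , refl , others
  where
  others : ∀ r → r ≢ 1 → part (1 ∷ []) r ≡ part [] r
  others zero ne = refl
  others (suc zero) ne = ⊥-elim (ne refl)
  others (suc (suc r)) ne = refl
cellAdded⇒oneCellMore (add-here {l} {ls}) = refl , refl , others
  where
  others : ∀ r → r ≢ 1 → part (suc l ∷ ls) r ≡ part (l ∷ ls) r
  others zero ne = refl
  others (suc zero) ne = ⊥-elim (ne refl)
  others (suc (suc r)) ne = refl
cellAdded⇒oneCellMore (add-there {l} {ls} {ms} {k} g) with cellAdded-row-suc g | cellAdded⇒oneCellMore g
... | k' , refl | grown , old , same = grown , old , others
  where
  others : ∀ r → r ≢ suc (suc k') → part (l ∷ ms) r ≡ part (l ∷ ls) r
  others zero ne = refl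
  others (suc zero) ne = refl
  others (suc (suc r)) ne = same (suc r) (λ e → ne (cong suc e))

oneCellMore⇒cellAdded : ∀ k lam mu c → All (1 ≤_) lam → All (1 ≤_) mu → 1 ≤ k →
  OneCellMore lam mu k c → CellAdded lam mu k c
oneCellMore⇒cellAdded zero lam mu c al am () _
oneCellMore⇒cellAdded (suc zero) lam [] c al am p (grown , old , same) = ⊥-elim (0≢1+n (trans grown (sym old)))
oneCellMore⇒cellAdded (suc zero) [] (m ∷ ms) c al (_ ∷ am) p (refl , old , same) with part-injective [] ms [] am rest-equal
  where
  rest-equal : ∀ r → part [] r ≡ part ms r
  rest-equal zero = sym (part-0 ms)
  rest-equal (suc r) = sym (same (suc (suc r)) (λ ()))
... | refl rewrite sym old = add-new
oneCellMore⇒cellAdded (suc zero) (l ∷ ls) (m ∷ ms) c (_ ∷ al) (_ ∷ am) p (refl , old , same) with part-injective ls ms al am rest-equal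
  where
  rest-equal : ∀ r → part ls r ≡ part ms r
  rest-equal zero = trans (part-0 ls) (sym (part-0 ms))
  rest-equal (suc r) = sym (same (suc (suc r)) (λ ()))
... | refl rewrite sym old = add-here
oneCellMore⇒cellAdded (suc (suc k)) [] [] c al am p (grown , old , same) = ⊥-elim (0≢1+n (trans grown (sym old)))
oneCellMore⇒cellAdded (suc (suc k)) [] (m ∷ ms) c al (q ∷ am) p (grown , old , same) = ⊥-elim (<⇒≢ q (sym (same 1 (λ ()))))
oneCellMore⇒cellAdded (suc (suc k)) (l ∷ ls) [] c (q ∷ al) am p (grown , old , same) = ⊥-elim (<⇒≢ q (same 1 (λ ())))
oneCellMore⇒cellAdded (suc (suc k)) (l ∷ ls) (m ∷ ms) c (_ ∷ al) (_ ∷ am) p (grown , old , same) with same 1 (λ ())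
... | refl = add-there (oneCellMore⇒cellAdded (suc k) ls ms c al am (s≤s z≤n) (grown , old , others))
  where
  others : ∀ r → r ≢ suc k → part ms r ≡ part ls r
  others zero ne = trans (part-0 ms) (sym (part-0 ls))
  others (suc r) ne = same (suc (suc r)) (λ e → ne (suc-injective e))

oneCellMore⇒covers : ∀ {lam mu k c} → 1 ≤ k → Partition mu → OneCellMore lam mu k c → Covers lam mu (k , c)
oneCellMore⇒covers {lam} {mu} {k} {c} kpos pm (grown , old , same) = pm , new , λ y → mk⇔ (to y) (from y)
  where
  new : ¬ InShape lam (k , c)
  new (_ , _ , le) = <⇒≱ (≤-reflexive old) le
  to : ∀ y → InShape mu y → InShape lam y ⊎ y ≡ (k , c)
  to (r , c') (a , b , le) with r ≟ k
  ... | no ne = inj₁ (a , b , subst (c' ≤_) (same r ne) le)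
  ... | yes refl with c' ≟ c
  ... | yes refl = inj₂ refl
  ... | no ne = inj₁ (a , b , ≤-pred (subst (suc c' ≤_) (sym old) (≤∧≢⇒< (subst (c' ≤_) grown le) ne)))
  from : ∀ y → InShape lam y ⊎ y ≡ (k , c) → InShape mu y
  from (r , c') (inj₁ (a , b , le)) with r ≟ k
  ... | no ne = a , b , subst (c' ≤_) (sym (same r ne)) le
  ... | yes refl = a , b , subst (c' ≤_) (sym grown) (≤-trans le (subst (part lam k ≤_) old (n≤1+n _)))
  from (r , c') (inj₂ refl) = kpos , subst (1 ≤_) old (s≤s z≤n) , ≤-reflexive (sym grown)

covers⇒oneCellMore : ∀ {lam mu k c} → Covers lam mu (k , c) → 1 ≤ k × OneCellMore lam mu k c
covers⇒oneCellMore {lam} {mu} {k} {c} (_ , new , eqv) = kpos , grown , old , λ r ne → sym (same r ne)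
  where
  open Equivalence
  xin : InShape mu (k , c)
  xin = from (eqv (k , c)) (inj₂ refl)
  kpos = proj₁ xin
  cpos = proj₁ (proj₂ xin)
  c≤mu = proj₂ (proj₂ xin)
  same : ∀ r → r ≢ k → part lam r ≡ part mu r
  same zero ne = trans (part-0 lam) (sym (part-0 mu))
  same (suc r) ne = ≤-antisym lam≤mu mu≤lam
    where
    lam≤mu : part lam (suc r) ≤ part mu (suc r)
    lam≤mu with part lam (suc r) in e
    ... | zero = z≤n
    ... | suc q = proj₂ (proj₂ (from (eqv (suc r , suc q)) (inj₁ (s≤s z≤n , s≤s z≤n , ≤-reflexive (sym e)))))
    mu≤lam : part mu (suc r) ≤ part lam (suc r)
    mu≤lam with part mu (suc r) in e
    ... | zero = z≤n
    ... | suc q with to (eqv (suc r , suc q)) (s≤s z≤n , s≤s z≤n , ≤-reflexive (sym e))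
    ... | inj₁ (_ , _ , le) = le
    ... | inj₂ refl = ⊥-elim (ne refl)
  grown : part mu k ≡ c
  grown with to (eqv (k , part mu k)) (kpos , ≤-trans cpos c≤mu , ≤-refl)
  ... | inj₁ (_ , _ , le) = ⊥-elim (new (kpos , cpos , ≤-trans c≤mu le))
  ... | inj₂ e = cong proj₂ e
  old : suc (part lam k) ≡ c
  old with to (eqv (k , suc (part lam k))) (kpos , s≤s z≤n , subst (suc (part lam k) ≤_) (sym grown) (≰⇒> (λ le → new (kpos , cpos , le))))
  ... | inj₁ (_ , _ , le) = ⊥-elim (<-irrefl refl le)
  ... | inj₂ e = cong proj₂ e

cellAdded⇒covers : ∀ {lam mu k c} → CellAdded lam mu k c → Partition mu → Covers lam mu (k , c)
cellAdded⇒covers {lam} {mu} g pm = oneCellMore⇒covers {lam} {mu} (cellAdded-row-positive g) pm (cellAdded⇒oneCellMore g)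

covers⇒cellAdded : ∀ {lam mu k c} → Partition lam → Covers lam mu (k , c) → CellAdded lam mu k c
covers⇒cellAdded {lam} {mu} {k} {c} (al , _) cov@((am , _) , _) with covers⇒oneCellMore {lam} {mu} cov
... | kpos , one = oneCellMore⇒cellAdded k lam mu c al am kpos one

-- Reverse row insertion

-- Reverse bumping: w, coming up from the row below, replaces the rightmost
-- entry of the row that is smaller than w, and that entry is expelled.
unbump : ℕ → List ℕ → ℕ × List ℕ
unbump w [] = 0 , []
unbump w (x ∷ []) = x , w ∷ []
unbump w (x ∷ y ∷ ys) =
  if suc y ≤ᵇ w then (proj₁ (unbump w (y ∷ ys)) , x ∷ proj₂ (unbump w (y ∷ ys))) else (x , w ∷ y ∷ ys)

unbumped : ℕ → List ℕ → ℕ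
unbumped w S = proj₁ (unbump w S)

unbumpRow : ℕ → List ℕ → List ℕ
unbumpRow w S = proj₂ (unbump w S)

unbump-∷ : ∀ w x L → Head (_< w) L → L ≢ [] → unbump w (x ∷ L) ≡ (unbumped w L , x ∷ unbumpRow w L)
unbump-∷ w x [] h ne = ⊥-elim (ne refl)
unbump-∷ w x (y ∷ ys) h ne rewrite ≤⇒≤ᵇ≡true h = refl

unbump-stop : ∀ w x y ys → w ≤ y → unbump w (x ∷ y ∷ ys) ≡ (x , w ∷ y ∷ ys)
unbump-stop w x y ys p rewrite >⇒≤ᵇ≡false {suc y} {w} (s≤s p) = refl

length-unbumpRow : ∀ w x xs → length (unbumpRow w (x ∷ xs)) ≡ length (x ∷ xs)
length-unbumpRow w x [] = refl
length-unbumpRow w x (y ∷ ys) with suc y ≤ᵇ w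
... | true = cong suc (length-unbumpRow w y ys)
... | false = refl

Head-unbumpRow : ∀ {P : ℕ → Set} w S → P w → Head P S → Head P (unbumpRow w S)
Head-unbumpRow w [] p h = tt
Head-unbumpRow w (x ∷ []) p h = p
Head-unbumpRow w (x ∷ y ∷ ys) p h with suc y ≤ᵇ w
... | true = h
... | false = p

≤-unbumped : ∀ w s ss → NonDecreasing (s ∷ ss) → s < w → s ≤ unbumped w (s ∷ ss)
≤-unbumped w s [] l p = ≤-refl
≤-unbumped w s (y ∷ ys) (sy ∷ l) p with suc y ≤ᵇ w in e
... | true = ≤-trans sy (≤-unbumped w y ys l (≤ᵇ≡true⇒≤ e))
... | false = ≤-refl

unbumpRow-nonDecreasing : ∀ w s ss → NonDecreasing (s ∷ ss) → s < w → NonDecreasing (unbumpRow w (s ∷ ss))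
unbumpRow-nonDecreasing w s [] l p = [-]
unbumpRow-nonDecreasing w s (y ∷ ys) (sy ∷ l) p with suc y ≤ᵇ w in e
... | true = Linked-∷ (Head-unbumpRow w (y ∷ ys) (<⇒≤ p) sy) (unbumpRow-nonDecreasing w y ys l (≤ᵇ≡true⇒≤ e))
... | false = ≤ᵇ≡false⇒≥ e ∷ l

unbumpRow-nonempty : ∀ w x xs → unbumpRow w (x ∷ xs) ≢ []
unbumpRow-nonempty w x xs e with cong length e
... | e2 = 0≢1+n (trans (sym e2) (length-unbumpRow w x xs))

insertRow-unbump : ∀ w s ss → NonDecreasing (s ∷ ss) → s < w →
  insertRow (unbumped w (s ∷ ss)) (unbumpRow w (s ∷ ss)) ≡ (just w , s ∷ ss)
insertRow-unbump w s [] l p rewrite ≤⇒≤ᵇ≡true p = refl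
insertRow-unbump w s (y ∷ ys) (sy ∷ l) p with suc y ≤ᵇ w in e
... | true rewrite >⇒≤ᵇ≡false {suc (unbumped w (y ∷ ys))} {s} (s≤s (≤-trans sy (≤-unbumped w y ys l (≤ᵇ≡true⇒≤ e))))
                 | insertRow-unbump w y ys l (≤ᵇ≡true⇒≤ e) = refl
... | false rewrite ≤⇒≤ᵇ≡true p = refl

unbump-insertRow : ∀ v S w → NonDecreasing S → bumped v S ≡ just w → unbump w (inserted v S) ≡ (v , S)
unbump-insertRow v [] w l ()
unbump-insertRow v (s ∷ ss) w l eq with suc v ≤ᵇ s in e
unbump-insertRow v (s ∷ []) w l refl | true = refl
unbump-insertRow v (s ∷ y ∷ ys) w (sy ∷ l) refl | true = unbump-stop s v y ys sy
... | false rewrite unbump-∷ w s (inserted v ss) (Head-inserted-<-bumped v ss w eq) (inserted-nonempty v ss)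
                  | unbump-insertRow v ss w (Linked-tail l) eq = refl

unbump-splits : ∀ v x xs → NonDecreasing (x ∷ xs) → x < v →
  Σ (List ℕ) λ L → Σ ℕ λ a → Σ (List ℕ) λ R → x ∷ xs ≡ L ++ a ∷ R × unbump v (x ∷ xs) ≡ (a , L ++ v ∷ R) × a < v
unbump-splits v x [] i p = [] , x , [] , refl , refl , p
unbump-splits v x (y ∷ ys) (xy ∷ i) p with suc y ≤ᵇ v in e
... | true with unbump-splits v y ys i (≤ᵇ≡true⇒≤ e)
... | L , a , R , e1 , e2 , q rewrite e2 = x ∷ L , a , R , cong (x ∷_) e1 , refl , q
unbump-splits v x (y ∷ ys) (xy ∷ i) p | false = [] , x , y ∷ ys , refl , refl , p

unbump-splits′ : ∀ v ρ → NonDecreasing ρ → HeadBelow v ρ →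
  Σ (List ℕ) λ L → Σ ℕ λ a → Σ (List ℕ) λ R → ρ ≡ L ++ a ∷ R × unbump v ρ ≡ (a , L ++ v ∷ R) × a < v
unbump-splits′ v [] i ()
unbump-splits′ v (x ∷ xs) i h = unbump-splits v x xs i h

unbumpRow-atop : ∀ s x xs ss → StrictlyAtop (x ∷ xs) ss → All (s <_) ss →
  StrictlyAtop (unbumpRow s (x ∷ xs)) ss
unbumpRow-atop s x [] [] b a = []
unbumpRow-atop s x [] (y ∷ l) (_ ∷ b) (p ∷ a) = p ∷ b
unbumpRow-atop s x (x2 ∷ xs) ss b a with suc x2 ≤ᵇ s
unbumpRow-atop s x (x2 ∷ xs) [] b a | true = []
unbumpRow-atop s x (x2 ∷ xs) (y ∷ l) (p ∷ b) (_ ∷ a) | true = p ∷ unbumpRow-atop s x2 xs l b a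
unbumpRow-atop s x (x2 ∷ xs) [] b a | false = []
unbumpRow-atop s x (x2 ∷ xs) (y ∷ l) (_ ∷ b) (p ∷ a) | false = p ∷ b

-- The entry expelled from the lower row lands weakly right of its column in the
-- upper row, which is what keeps the columns strict.
unbumpRow-atop-unbumpRow : ∀ w r rs s ss → NonDecreasing (r ∷ rs) → NonDecreasing (s ∷ ss) →
  StrictlyAtop (r ∷ rs) (s ∷ ss) → s < w →
     StrictlyAtop (unbumpRow (unbumped w (s ∷ ss)) (r ∷ rs)) (unbumpRow w (s ∷ ss))
unbumpRow-atop-unbumpRow w r rs s [] lR lS (r<s ∷ b) p =
  atop-singleton (unbumpRow s (r ∷ rs)) (unbumpRow-nonempty s r rs) (Head-unbumpRow s (r ∷ rs) p (<-trans r<s p))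
unbumpRow-atop-unbumpRow w r [] s (y ∷ ys) lR lS (r<s ∷ ()) p
unbumpRow-atop-unbumpRow w r (r2 ∷ rs2) s (y ∷ ys) lR (sy ∷ lS) (r<s ∷ r2<y ∷ b) p with suc y ≤ᵇ w in e
... | true rewrite unbump-∷ (unbumped w (y ∷ ys)) r (r2 ∷ rs2) (<-≤-trans r2<y (≤-unbumped w y ys lS (≤ᵇ≡true⇒≤ e))) (λ ())
  = r<s ∷ unbumpRow-atop-unbumpRow w r2 rs2 y ys (Linked-tail lR) lS (r2<y ∷ b) (≤ᵇ≡true⇒≤ e)
... | false with suc r2 ≤ᵇ s in e2
... | true = <-trans r<s p ∷ 
   (unbumpRow-atop s r2 rs2 (y ∷ ys) (r2<y ∷ b)
     (allMap (λ q → <-≤-trans p (≤-trans (≤ᵇ≡false⇒≥ e) q)) (Linked⇒All ≤-trans ≤-refl lS)))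
... | false = p ∷ r2<y ∷ b

unbumpRow-atop-init : ∀ v R S0 → NonDecreasing R → NonDecreasing (S0 ++ [ v ]) →
  StrictlyAtop R (S0 ++ [ v ]) → StrictlyAtop (unbumpRow v R) S0
unbumpRow-atop-init v R [] lR lS b = []
unbumpRow-atop-init v (r ∷ []) (s ∷ S1) lR lS (r<s ∷ b) = ⊥-elim ([]-not-atop S1 v b)
unbumpRow-atop-init v (r ∷ r2 ∷ rs2) (s ∷ S1) lR lS (r<s ∷ b)
  rewrite unbump-∷ v r (r2 ∷ rs2) (atop-first-<-last r2 rs2 S1 v b (Linked-tail lS)) (λ ())
  = r<s ∷ unbumpRow-atop-init v (r2 ∷ rs2) S1 (Linked-tail lR) (Linked-tail lS) b

popLast : List ℕ → ℕ × List ℕ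
popLast [] = 0 , []
popLast (x ∷ []) = x , []
popLast (x ∷ y ∷ ys) = proj₁ (popLast (y ∷ ys)) , x ∷ proj₂ (popLast (y ∷ ys))

popLast-∷ʳ : ∀ S v → popLast (S ++ [ v ]) ≡ (v , S)
popLast-∷ʳ [] v = refl
popLast-∷ʳ (x ∷ []) v = refl
popLast-∷ʳ (x ∷ z ∷ S) v rewrite popLast-∷ʳ (z ∷ S) v = refl

consNonEmpty : List ℕ → List (List ℕ) → List (List ℕ)
consNonEmpty [] rest = rest
consNonEmpty (x ∷ xs) rest = (x ∷ xs) ∷ rest

-- Undoes insertRows when the insertion ended in row k (counted from 1): the
-- last entry of row k is reverse-bumped up to the first row, which expels the
-- entry that was inserted.
uninsertRows : ℕ → List (List ℕ) → ℕ × List (List ℕ)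
uninsertRows zero _ = 0 , []
uninsertRows (suc k) [] = 0 , []
uninsertRows (suc zero) (S ∷ rest) = proj₁ (popLast S) , consNonEmpty (proj₂ (popLast S)) rest
uninsertRows (suc (suc k)) (S ∷ rest) =
  unbumped (proj₁ (uninsertRows (suc k) rest)) S ,
  unbumpRow (proj₁ (uninsertRows (suc k) rest)) S ∷ proj₂ (uninsertRows (suc k) rest)

-- What is known after expelling v from the rows Q, leaving the rows B, when
-- the cell (k , c) is removed and the row R sits above Q.
record Uninsertion (v : ℕ) (B Q : List (List ℕ)) (R : List ℕ) (k c : ℕ) : Set where
  constructor uninsertion
  field
    expelled-fits : HeadBelow v R
    unbumped-nonDecreasing : NonDecreasing (unbumpRow v R)
    rows-nonDecreasing : All NonDecreasing B
    columns-strict : Linked StrictlyAtop (unbumpRow v R ∷ B)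
    reinsert : insertRows v B ≡ Q
    shape : CellAdded (map length B) (map length Q) k c
    rows-nonEmpty : All NonEmpty B

Uninserted : ℕ → List (List ℕ) → List ℕ → ℕ → Set
Uninserted k Q R c = Uninsertion (proj₁ (uninsertRows k Q)) (proj₂ (uninsertRows k Q)) Q R k c

uninsertRows-row1 : ∀ S0 v rest R lam c → CellAdded lam (length (S0 ++ [ v ]) ∷ map length rest) 1 c →
  Linked _≥_ lam → All NonEmpty rest → NonDecreasing R → NonDecreasing (S0 ++ [ v ]) → All NonDecreasing rest →
  StrictlyAtop R (S0 ++ [ v ]) → Linked StrictlyAtop ((S0 ++ [ v ]) ∷ rest) → Uninserted 1 ((S0 ++ [ v ]) ∷ rest) R c
uninsertRows-row1 S0 v rest [] lam c g dec neRest iR iS iRest b lRest = ⊥-elim ([]-not-atop S0 v b)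
uninsertRows-row1 [] v [] (r ∷ rs) lam c g dec neRest iR iS iRest (r<v ∷ _) lRest with cellAdded-row1 g
... | inj₁ (_ , _ , _ , refl) = uninsertion r<v (unbumpRow-nonDecreasing v r rs iR r<v) [] [-] refl add-new []
... | inj₂ (l , refl , e1 , e2) rewrite sym (suc-injective e1) | e2 =
  uninsertion r<v (unbumpRow-nonDecreasing v r rs iR r<v) [] [-] refl add-new []
uninsertRows-row1 [] v (T ∷ rest) (r ∷ rs) lam c g dec (neT ∷ neRest) iR iS iRest (r<v ∷ _) lRest with cellAdded-row1 g
... | inj₁ (_ , _ , () , _)
... | inj₂ (l , refl , e1 , e2) with dec
... | le ∷ _ rewrite sym (suc-injective e1) with T
... | [] = ⊥-elim (neT refl)
... | t ∷ T' with le
... | ()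
uninsertRows-row1 (s ∷ S1) v rest (r ∷ rs) lam c g dec neRest iR iS iRest bRS lRest
  rewrite popLast-∷ʳ (s ∷ S1) v with cellAdded-row1 g
... | inj₁ (_ , e , _ , _) = ⊥-elim (1+n≢0 (suc-injective (trans (sym (length-∷ʳ (s ∷ S1) v)) e)))
... | inj₂ (l , refl , e1 , refl) =
  uninsertion r<v (unbumpRow-nonDecreasing v r rs iR r<v) (nonDecreasing-init (s ∷ S1) v iS ∷ iRest)
    (unbumpRow-atop-init v (r ∷ rs) (s ∷ S1) iR iS bRS ∷ Linked-replaceHead lRest (below-shorter rest (Linked-head dec)))
    (insertRows-stop v (s ∷ S1) rest _ (insertRow-≥-appends v (s ∷ S1) (≤-last (s ∷ S1) v iS)))
    (subst (λ m → CellAdded (suc (length S1) ∷ map length rest) (m ∷ map length rest) 1 (suc l))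
       (sym (length-∷ʳ (s ∷ S1) v)) (subst (λ m → CellAdded _ _ 1 (suc m)) (sym l≡) add-here))
    ((λ ()) ∷ neRest)
  where
  r<v : r < v
  r<v = atop-first-<-last r rs (s ∷ S1) v bRS iS
  l≡ : l ≡ suc (length S1)
  l≡ = suc-injective (trans (sym e1) (length-∷ʳ (s ∷ S1) v))
  below-shorter : ∀ rest → Head (_≥_ l) (map length rest) →
    Head (StrictlyAtop ((s ∷ S1) ++ [ v ])) rest → Head (StrictlyAtop (s ∷ S1)) rest
  below-shorter [] h b = tt
  below-shorter (T ∷ rest) h b = atop-init (s ∷ S1) v T b (subst (length T ≤_) l≡ h)

uninsertRows-correct : ∀ k Q R lam c → CellAdded lam (map length Q) k c → Linked _≥_ lam → All NonEmpty Q →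
  NonDecreasing R → All NonDecreasing Q → Linked StrictlyAtop (R ∷ Q) → Uninserted k Q R c
uninsertRows-correct zero Q R lam c g dec ne iR iQ lQ = ⊥-elim (¬cellAdded-row0 g)
uninsertRows-correct (suc k) [] R lam c () dec ne iR iQ lQ
uninsertRows-correct (suc zero) (S ∷ rest) R lam c g dec (neS ∷ neRest) iR (iS ∷ iRest) (bRS ∷ lRest)
  with initLast S
... | [] = ⊥-elim (neS refl)
... | S0 ∷ʳ′ v = uninsertRows-row1 S0 v rest R lam c g dec neRest iR iS iRest bRS lRest
uninsertRows-correct (suc (suc k)) ([] ∷ Q) R lam c g dec (neS ∷ neQ) iR iQ lQ = ⊥-elim (neS refl)
uninsertRows-correct (suc (suc k)) ((s ∷ ss) ∷ Q) [] lam c g dec ne iR iQ (() ∷ _)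
uninsertRows-correct (suc (suc k)) ((s ∷ ss) ∷ Q) (r ∷ rs) lam c g dec (neS ∷ neQ) iR (iS ∷ iQ) (bRS@(r<s ∷ _) ∷ lSQ)
  with cellAdded-row≥2 g
... | lam' , refl , g' with uninsertRows-correct (suc k) Q (s ∷ ss) lam' c g' (Linked-tail dec) neQ iS iQ lSQ
... | uninsertion w<s iS' iB lB reinsert shape neB =
  uninsertion r<v (unbumpRow-nonDecreasing v r rs iR r<v) (iS' ∷ iB)
    (unbumpRow-atop-unbumpRow w r rs s ss iR iS bRS w<s ∷ lB)
    (trans (insertRows-bump v (unbumpRow w (s ∷ ss)) _ w (s ∷ ss) (insertRow-unbump w s ss iS w<s))
           (cong ((s ∷ ss) ∷_) reinsert))
    (subst (λ m → CellAdded (m ∷ map length (proj₂ (uninsertRows (suc k) Q))) _ _ c)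
       (sym (length-unbumpRow w s ss)) (add-there shape))
    (unbumpRow-nonempty w s ss ∷ neB)
  where
  w = proj₁ (uninsertRows (suc k) Q)
  v = unbumped w (s ∷ ss)
  r<v = <-≤-trans r<s (≤-unbumped w s ss iS w<s)

uninsertRows-insertRows : ∀ v B → All NonDecreasing B → All NonEmpty B → Σ ℕ λ k → Σ ℕ λ c →
  CellAdded (map length B) (map length (insertRows v B)) k c × uninsertRows k (insertRows v B) ≡ (v , B)
uninsertRows-insertRows v [] iB neB = 1 , 1 , add-new , refl
uninsertRows-insertRows v ([] ∷ B) iB (neS ∷ neB) = ⊥-elim (neS refl)
uninsertRows-insertRows v ((s ∷ ss) ∷ B) (iS ∷ iB) (neS ∷ neB) with insertRow v (s ∷ ss) in e
... | nothing , S' rewrite sym (cong proj₂ e) | inserted-appends v (s ∷ ss) (cong proj₁ e) =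
  1 , suc (suc (length ss)) ,
  subst (λ m → CellAdded (suc (length ss) ∷ map length B) (m ∷ map length B) 1 (suc (suc (length ss))))
    (sym (length-∷ʳ (s ∷ ss) v)) add-here ,
  cong (λ p → proj₁ p , consNonEmpty (proj₂ p) B) (popLast-∷ʳ (s ∷ ss) v)
... | just w , S' with uninsertRows-insertRows w B iB neB
... | k , c , g , eq with cellAdded-row-suc g
... | k' , refl =
  suc k , c ,
  subst (λ m → CellAdded (suc (length ss) ∷ map length B) (m ∷ map length (insertRows w B)) (suc k) c)
    (trans (sym (length-inserted v (s ∷ ss) w (cong proj₁ e))) (cong (λ p → length (proj₂ p)) e)) (add-there g) ,
  reverses
  where
  reverses : uninsertRows (suc (suc k')) (S' ∷ insertRows w B) ≡ (v , (s ∷ ss) ∷ B)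
  reverses rewrite eq | sym (cong proj₂ e) | unbump-insertRow v (s ∷ ss) w iS (cong proj₁ e) = refl

-- Set-valued tableaux via adjacent cells

_≼_ : List ℕ → List ℕ → Set
s ≼ s' = ∀ a b → a ∈ s → b ∈ s' → a ≤ b

_≺_ : List ℕ → List ℕ → Set
s ≺ s' = ∀ a b → a ∈ s → b ∈ s' → a < b

ValidCell : List ℕ → Set
ValidCell s = (s ≢ []) × AllPairs _<_ s × All (1 ≤_) s

-- The conditions of a set-valued tableau imposed on adjacent cells only; since
-- cells are nonempty, ≼ and ≺ compose through them, so this is equivalent.
LocalSVT : List (List (List ℕ)) → Set
LocalSVT T = All (All ValidCell) T × All (Linked _≼_) T × Linked (Atop _≺_) T

cell-split : ∀ T r c {s} → cell T r c ≡ just s → Σ (List (List ℕ)) λ row →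
  at T r ≡ just row × at row c ≡ just s
cell-split T r c e with at T r
cell-split T r c () | nothing
... | just row = row , refl , e

cell-intro : ∀ T r c {row s} → at T r ≡ just row → at row c ≡ just s → cell T r c ≡ just s
cell-intro T r c e1 e2 with at T r
cell-intro T r c () e2 | nothing
cell-intro T r c refl e2 | just row = e2

≼-trans : ∀ {x y z} → y ≢ [] → x ≼ y → y ≼ z → x ≼ z
≼-trans {y = []} ne xy yz = ⊥-elim (ne refl)
≼-trans {y = b ∷ y} ne xy yz a c a∈x c∈z = ≤-trans (xy a b a∈x (here refl)) (yz b c (here refl) c∈z)

≺-trans : ∀ {x y z} → y ≢ [] → x ≺ y → y ≺ z → x ≺ z
≺-trans {y = []} ne xy yz = ⊥-elim (ne refl)
≺-trans {y = b ∷ y} ne xy yz a c a∈x c∈z = <-trans (xy a b a∈x (here refl)) (yz b c (here refl) c∈z)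

localSVT⇒svt : ∀ T → LocalSVT T → SetValuedTableau (map length T) T
localSVT⇒svt T (valid , rows , columns) = refl , cells-valid , rows-weak , columns-strict
  where
  cells-valid : ∀ r c s → cell T r c ≡ just s → ValidCell s
  cells-valid r c s e with cell-split T r c e
  ... | row , e1 , e2 = All-at c (All-at r valid e1) e2
  rows-weak : ∀ r c c' s s' → c < c' → cell T r c ≡ just s → cell T r c' ≡ just s' → s ≼ s'
  rows-weak r c c' s s' lt e e' with cell-split T r c e | cell-split T r c' e'
  ... | row , e1 , e2 | row' , e1' , e2' with trans (sym e1) e1'
  ... | refl = Linked-at (λ p → ≼-trans (proj₁ p)) row c c' (All-at r valid e1) (All-at r rows e1) lt e2 e2'
  columns-strict : ∀ r r' c s s' → r < r' → cell T r c ≡ just s → cell T r' c ≡ just s' → s ≺ s'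
  columns-strict r r' c s s' lt e e' with cell-split T r c e | cell-split T r' c e'
  ... | row , e1 , e2 | row' , e1' , e2' with column-at (λ p → ≺-trans (proj₁ p)) T r r' c valid columns lt e1 e1' e2'
  ... | s'' , e3 , h with trans (sym e2) e3
  ... | refl = h

svt⇒localSVT : ∀ T lam → Partition lam → SetValuedTableau lam T → LocalSVT T
svt⇒localSVT T lam (_ , decreasing) (refl , cells-valid , rows-weak , columns-strict) =
  at-All T (λ r row e → at-All row (λ c s e' → cells-valid r c s (cell-intro T r c e e'))) ,
  at-All T (λ r row e → at-Linked row (λ c s s' e1 e2 →
     rows-weak r (suc c) (suc (suc c)) s s' ≤-refl (cell-intro T r (suc c) e e1) (cell-intro T r (suc (suc c)) e e2))) ,
  at-Linked T (λ r X Y e1 e2 →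
     at-Atop X Y (AllPairs-adjacent r decreasing (at-map length T (suc r) e1) (at-map length T (suc (suc r)) e2))
       (λ c s t e3 e4 → columns-strict (suc r) (suc (suc r)) c s t ≤-refl
                          (cell-intro T (suc r) c e1 e3) (cell-intro T (suc (suc r)) c e2 e4)))

singletons : List ℕ → List (List ℕ)
singletons = map [_]

≤⇒[≼] : ∀ {x y} → x ≤ y → [ x ] ≼ [ y ]
≤⇒[≼] p a b (here refl) (here refl) = p

<⇒[≺] : ∀ {x y} → x < y → [ x ] ≺ [ y ]
<⇒[≺] p a b (here refl) (here refl) = p

singletons-nonDecreasing⁻ : ∀ r → Linked _≼_ (singletons r) → NonDecreasing r
singletons-nonDecreasing⁻ r l = Linked-map (λ h → h _ _ (here refl) (here refl)) (Linked-map⁻ l)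

singletons-nonDecreasing⁺ : ∀ r → NonDecreasing r → Linked _≼_ (singletons r)
singletons-nonDecreasing⁺ r l = Linked-map⁺ (Linked-map ≤⇒[≼] l)

singletons-atop⁻ : ∀ X Y → Atop _≺_ (singletons X) (singletons Y) → StrictlyAtop X Y
singletons-atop⁻ = Atop-map⁻ [_] (λ h → h _ _ (here refl) (here refl))

singletons-atop⁺ : ∀ X Y → StrictlyAtop X Y → Atop _≺_ (singletons X) (singletons Y)
singletons-atop⁺ = Atop-map⁺ [_] <⇒[≺]

singletons-columns⁻ : ∀ U → Linked (Atop _≺_) (map singletons U) → Linked StrictlyAtop U
singletons-columns⁻ U l = Linked-map (singletons-atop⁻ _ _) (Linked-map⁻ l)

singletons-columns⁺ : ∀ U → Linked StrictlyAtop U → Linked (Atop _≺_) (map singletons U)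
singletons-columns⁺ U l = Linked-map⁺ (Linked-map (singletons-atop⁺ _ _) l)

validCell-[]⁻ : ∀ {x} → ValidCell [ x ] → 1 ≤ x
validCell-[]⁻ (_ , _ , p ∷ _) = p

validCell-[]⁺ : ∀ {x} → 1 ≤ x → ValidCell [ x ]
validCell-[]⁺ p = (λ ()) , [] ∷ [] , p ∷ []

singletons-valid⁻ : ∀ r → All ValidCell (singletons r) → All (1 ≤_) r
singletons-valid⁻ r a = allMap validCell-[]⁻ (map⁻ a)

singletons-valid⁺ : ∀ r → All (1 ≤_) r → All ValidCell (singletons r)
singletons-valid⁺ r a = map⁺ (allMap validCell-[]⁺ a)

singletonRows-valid⁻ : ∀ U → All (All ValidCell) (map singletons U) → All (All (1 ≤_)) U
singletonRows-valid⁻ U v = allMap (λ {r} → singletons-valid⁻ r) (map⁻ v)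

singletonRows-valid⁺ : ∀ U → All (All (1 ≤_)) U → All (All ValidCell) (map singletons U)
singletonRows-valid⁺ U p = map⁺ (allMap (λ {r} → singletons-valid⁺ r) p)

singletonRows-nonDecreasing⁻ : ∀ U → All (Linked _≼_) (map singletons U) → All NonDecreasing U
singletonRows-nonDecreasing⁻ U l = allMap (λ {r} → singletons-nonDecreasing⁻ r) (map⁻ l)

singletonRows-nonDecreasing⁺ : ∀ U → All NonDecreasing U → All (Linked _≼_) (map singletons U)
singletonRows-nonDecreasing⁺ U l = map⁺ (allMap (λ {r} → singletons-nonDecreasing⁺ r) l)

record Semistandard (U : List (List ℕ)) : Set where
  constructor semistandard
  field
    entries-positive : All (All (1 ≤_)) U
    rows-nonDecreasing : All NonDecreasing U
    columns-strict : Linked StrictlyAtop U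

localSVT⇒semistandard : ∀ U → LocalSVT (map singletons U) → Semistandard U
localSVT⇒semistandard U (valid , rows , columns) =
  semistandard (singletonRows-valid⁻ U valid) (singletonRows-nonDecreasing⁻ U rows) (singletons-columns⁻ U columns)

semistandard⇒localSVT : ∀ U → Semistandard U → LocalSVT (map singletons U)
semistandard⇒localSVT U (semistandard positive rows columns) =
  singletonRows-valid⁺ U positive , singletonRows-nonDecreasing⁺ U rows , singletons-columns⁺ U columns

length-singletons : ∀ r → length (singletons r) ≡ length r
length-singletons [] = refl
length-singletons (x ∷ r) = cong suc (length-singletons r)

shape-singletons : ∀ U → map length (map singletons U) ≡ map length U
shape-singletons [] = refl
shape-singletons (r ∷ U) = cong₂ _∷_ (length-singletons r) (shape-singletons U)

Singleton : List ℕ → Set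
Singleton s = length s ≡ 1

singleton-headOr : ∀ s → Singleton s → s ≡ [ headOr s ]
singleton-headOr (x ∷ []) e = refl

singletons-headOr : ∀ row → All Singleton row → row ≡ singletons (map headOr row)
singletons-headOr [] a = refl
singletons-headOr (s ∷ row) (p ∷ a) = cong₂ _∷_ (singleton-headOr s p) (singletons-headOr row a)

singletonRows-headOr : ∀ X → All (All Singleton) X → X ≡ map singletons (map (map headOr) X)
singletonRows-headOr [] a = refl
singletonRows-headOr (r ∷ X) (p ∷ a) = cong₂ _∷_ (singletons-headOr r p) (singletonRows-headOr X a)

singletons-singleton : ∀ r → All Singleton (singletons r)
singletons-singleton [] = []
singletons-singleton (x ∷ r) = refl ∷ singletons-singleton r

singletonRows-singleton : ∀ B → All (All Singleton) (map singletons B)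
singletonRows-singleton [] = []
singletonRows-singleton (r ∷ B) = singletons-singleton r ∷ singletonRows-singleton B

-- Barely set-valued tableaux

-- barely A L a b R B has the doubled cell {a , b} in row |A| + 1, column |L| + 1.
barelyRow : List ℕ → ℕ → ℕ → List ℕ → List (List ℕ)
barelyRow L a b R = singletons L ++ (a ∷ b ∷ []) ∷ singletons R

barely : List (List ℕ) → List ℕ → ℕ → ℕ → List ℕ → List (List ℕ) → List (List (List ℕ))
barely A L a b R B = map singletons A ++ barelyRow L a b R ∷ map singletons B

-- Keeping only a in the doubled cell must give a semistandard tableau, and
-- keeping only b must keep row i₀ and the columns below it valid.
record BarelyValid (A : List (List ℕ)) (L : List ℕ) (a b : ℕ) (R : List ℕ) (B : List (List ℕ)) : Set where
  constructor barelyValid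
  field
    with-a : Semistandard (A ++ (L ++ a ∷ R) ∷ B)
    a<b : a < b
    row-with-b : NonDecreasing (L ++ b ∷ R)
    below-with-b : Linked StrictlyAtop ((L ++ b ∷ R) ∷ B)

x∈[x] : ∀ {x : ℕ} → x ∈ (x ∷ [])
x∈[x] = here refl

x∈[x,y] : ∀ {x y : ℕ} → x ∈ (x ∷ y ∷ [])
x∈[x,y] = here refl

y∈[x,y] : ∀ {x y : ℕ} → y ∈ (x ∷ y ∷ [])
y∈[x,y] = there (here refl)

module BarelyRow {a b : ℕ} {R : List ℕ} (a<b : a < b) where

  pair-head⁻ : ∀ R' → Head ((a ∷ b ∷ []) ≼_) (singletons R') → Head (a ≤_) R' × Head (b ≤_) R'
  pair-head⁻ [] h = tt , tt
  pair-head⁻ (y ∷ R') h = h a y x∈[x,y] x∈[x] , h b y y∈[x,y] x∈[x]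

  pair-head⁺ : ∀ R' → Head (b ≤_) R' → Head ((a ∷ b ∷ []) ≼_) (singletons R')
  pair-head⁺ [] h = tt
  pair-head⁺ (y ∷ R') h .a .y (here refl) (here refl) = ≤-trans (<⇒≤ a<b) h
  pair-head⁺ (y ∷ R') h .b .y (there (here refl)) (here refl) = h

  single-head⁻ : ∀ {x} L → Head ([ x ] ≼_) (singletons L ++ (a ∷ b ∷ []) ∷ singletons R) →
    Head (x ≤_) (L ++ a ∷ R) × Head (x ≤_) (L ++ b ∷ R)
  single-head⁻ {x} [] h = h x a x∈[x] x∈[x,y] , h x b x∈[x] y∈[x,y]
  single-head⁻ {x} (y ∷ L) h = h x y x∈[x] x∈[x] , h x y x∈[x] x∈[x]

  single-head⁺ : ∀ {x} L → Head (x ≤_) (L ++ a ∷ R) → Head (x ≤_) (L ++ b ∷ R) →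
    Head ([ x ] ≼_) (singletons L ++ (a ∷ b ∷ []) ∷ singletons R)
  single-head⁺ {x} [] h h' .x .a (here refl) (here refl) = h
  single-head⁺ {x} [] h h' .x .b (here refl) (there (here refl)) = h'
  single-head⁺ (y ∷ L) h h' = ≤⇒[≼] h

  row⁻ : ∀ L → Linked _≼_ (barelyRow L a b R) → NonDecreasing (L ++ a ∷ R) × NonDecreasing (L ++ b ∷ R)
  row⁻ [] l with pair-head⁻ R (Linked-head l)
  ... | p , q = Linked-∷ p (singletons-nonDecreasing⁻ R (Linked-tail l)) , Linked-∷ q (singletons-nonDecreasing⁻ R (Linked-tail l))
  row⁻ (x ∷ L) l with row⁻ L (Linked-tail l) | single-head⁻ L (Linked-head l)
  ... | i1 , i2 | p , q = Linked-∷ p i1 , Linked-∷ q i2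

  row⁺ : ∀ L → NonDecreasing (L ++ a ∷ R) → NonDecreasing (L ++ b ∷ R) → Linked _≼_ (barelyRow L a b R)
  row⁺ [] i1 i2 = Linked-∷ (pair-head⁺ R (Linked-head i2)) (singletons-nonDecreasing⁺ R (Linked-tail i2))
  row⁺ (x ∷ L) i1 i2 = Linked-∷ (single-head⁺ L (Linked-head i1) (Linked-head i2)) (row⁺ L (Linked-tail i1) (Linked-tail i2))

  above⁻ : ∀ X L → Atop _≺_ (singletons X) (barelyRow L a b R) → StrictlyAtop X (L ++ a ∷ R)
  above⁻ [] L bb = ⊥-elim (no-upper-row L bb)
    where
    no-upper-row : ∀ L → Atop _≺_ [] (barelyRow L a b R) → ⊥
    no-upper-row [] ()
    no-upper-row (_ ∷ _) ()
  above⁻ (x ∷ X) [] (r ∷ bb) = r x a x∈[x] x∈[x,y] ∷ singletons-atop⁻ X R bb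
  above⁻ (x ∷ X) (y ∷ L) (r ∷ bb) = r x y x∈[x] x∈[x] ∷ (above⁻ X L bb)

  above⁺ : ∀ X L → StrictlyAtop X (L ++ a ∷ R) → Atop _≺_ (singletons X) (barelyRow L a b R)
  above⁺ (x ∷ X) [] (r ∷ bb) = cell-related ∷ singletons-atop⁺ X R bb
    where
    cell-related : [ x ] ≺ (a ∷ b ∷ [])
    cell-related .x .a (here refl) (here refl) = r
    cell-related .x .b (here refl) (there (here refl)) = <-trans r a<b
  above⁺ (x ∷ X) (y ∷ L) (r ∷ bb) = <⇒[≺] r ∷ above⁺ X L bb

  below⁻ : ∀ L Y → Atop _≺_ (barelyRow L a b R) (singletons Y) → StrictlyAtop (L ++ b ∷ R) Y
  below⁻ L [] bb = []
  below⁻ [] (y ∷ Y) (r ∷ bb) = r b y y∈[x,y] x∈[x] ∷ singletons-atop⁻ R Y bb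
  below⁻ (x ∷ L) (y ∷ Y) (r ∷ bb) = r x y x∈[x] x∈[x] ∷ (below⁻ L Y bb)

  below⁺ : ∀ L Y → StrictlyAtop (L ++ b ∷ R) Y → Atop _≺_ (barelyRow L a b R) (singletons Y)
  below⁺ L [] bb = []
  below⁺ [] (y ∷ Y) (r ∷ bb) = cell-related ∷ singletons-atop⁺ R Y bb
    where
    cell-related : (a ∷ b ∷ []) ≺ [ y ]
    cell-related .a .y (here refl) (here refl) = <-trans a<b r
    cell-related .b .y (there (here refl)) (here refl) = r
  below⁺ (x ∷ L) (y ∷ Y) (r ∷ bb) = <⇒[≺] r ∷ below⁺ L Y bb

  atop-lower : ∀ L Y → StrictlyAtop (L ++ b ∷ R) Y → StrictlyAtop (L ++ a ∷ R) Y
  atop-lower L [] bb = []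
  atop-lower [] (y ∷ Y) (r ∷ bb) = <-trans a<b r ∷ bb
  atop-lower (x ∷ L) (y ∷ Y) (r ∷ bb) = r ∷ atop-lower L Y bb

  columns⁻ : ∀ A L B → Linked (Atop _≺_) (map singletons A ++ barelyRow L a b R ∷ map singletons B) →
         Linked StrictlyAtop (A ++ (L ++ a ∷ R) ∷ B) × Linked StrictlyAtop ((L ++ b ∷ R) ∷ B)
  columns⁻ [] L B l = Linked-∷ (head-with-a B (Linked-head l)) tl , Linked-∷ (head-related B (Linked-head l)) tl
    where
    tl = singletons-columns⁻ B (Linked-tail l)
    head-related : ∀ B → Head (Atop _≺_ (barelyRow L a b R)) (map singletons B) → Head (StrictlyAtop (L ++ b ∷ R)) B
    head-related [] h = tt
    head-related (Y ∷ B) h = below⁻ L Y h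
    head-with-a : ∀ B → Head (Atop _≺_ (barelyRow L a b R)) (map singletons B) → Head (StrictlyAtop (L ++ a ∷ R)) B
    head-with-a [] h = tt
    head-with-a (Y ∷ B) h = atop-lower L Y (below⁻ L Y h)
  columns⁻ (X ∷ A) L B l with columns⁻ A L B (Linked-tail l)
  ... | l1 , l2 = Linked-∷ (head-related A (Linked-head l)) l1 , l2
    where
    head-related : ∀ A →
      Head (Atop _≺_ (singletons X)) (map singletons A ++ barelyRow L a b R ∷ map singletons B) →
      Head (StrictlyAtop X) (A ++ (L ++ a ∷ R) ∷ B)
    head-related [] h = above⁻ X L h
    head-related (X' ∷ A) h = singletons-atop⁻ X X' h

  columns⁺ : ∀ A L B → Linked StrictlyAtop (A ++ (L ++ a ∷ R) ∷ B) → Linked StrictlyAtop ((L ++ b ∷ R) ∷ B) →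
         Linked (Atop _≺_) (map singletons A ++ barelyRow L a b R ∷ map singletons B)
  columns⁺ [] L B l1 l2 = Linked-∷ (head-related B (Linked-head l2)) (singletons-columns⁺ B (Linked-tail l2))
    where
    head-related : ∀ B → Head (StrictlyAtop (L ++ b ∷ R)) B → Head (Atop _≺_ (barelyRow L a b R)) (map singletons B)
    head-related [] h = tt
    head-related (Y ∷ B) h = below⁺ L Y h
  columns⁺ (X ∷ A) L B l1 l2 = Linked-∷ (head-related A (Linked-head l1)) (columns⁺ A L B (Linked-tail l1) l2)
    where
    head-related : ∀ A → Head (StrictlyAtop X) (A ++ (L ++ a ∷ R) ∷ B) →
      Head (Atop _≺_ (singletons X)) (map singletons A ++ barelyRow L a b R ∷ map singletons B)
    head-related [] h = above⁺ X L h
    head-related (X' ∷ A) h = singletons-atop⁺ X X' h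

localSVT⇒barelyValid : ∀ A L a b R B → LocalSVT (barely A L a b R B) → BarelyValid A L a b R B
localSVT⇒barelyValid A L a b R B (valid , rows , columns)
  with All-split (map singletons A) (barelyRow L a b R) (map singletons B) valid
     | All-split (map singletons A) (barelyRow L a b R) (map singletons B) rows
... | vA , vρ , vB | rA , rρ , rB with All-split (singletons L) (a ∷ b ∷ []) (singletons R) vρ
... | vL , (_ , (a<b ∷ []) ∷ _ , a-positive ∷ _) , vR
  with BarelyRow.row⁻ {a} {b} {R} a<b L rρ | BarelyRow.columns⁻ {a} {b} {R} a<b A L B columns
... | rρa , rρb | columns-a , columns-b =
  barelyValid
    (semistandard (All-join (singletonRows-valid⁻ A vA) (All-join (singletons-valid⁻ L vL) a-positive (singletons-valid⁻ R vR))
                            (singletonRows-valid⁻ B vB))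
                  (All-join (singletonRows-nonDecreasing⁻ A rA) rρa (singletonRows-nonDecreasing⁻ B rB))
                  columns-a)
    a<b rρb columns-b

barelyValid⇒localSVT : ∀ A L a b R B → BarelyValid A L a b R B → LocalSVT (barely A L a b R B)
barelyValid⇒localSVT A L a b R B (barelyValid (semistandard positive rows columns) a<b rρb columns-b)
  with All-split A (L ++ a ∷ R) B positive | All-split A (L ++ a ∷ R) B rows
... | pA , pρ , pB | rA , rρa , rB with All-split L a R pρ
... | pL , pa , pR =
  All-join (singletonRows-valid⁺ A pA) (All-join (singletons-valid⁺ L pL) pair-valid (singletons-valid⁺ R pR)) (singletonRows-valid⁺ B pB) ,
  All-join (singletonRows-nonDecreasing⁺ A rA) (BarelyRow.row⁺ {a} {b} {R} a<b L rρa rρb) (singletonRows-nonDecreasing⁺ B rB) ,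
  BarelyRow.columns⁺ {a} {b} {R} a<b A L B columns columns-b
  where
  pair-valid : ValidCell (a ∷ b ∷ [])
  pair-valid = (λ ()) , (a<b ∷ []) ∷ [] ∷ [] , pa ∷ ≤-trans pa (<⇒≤ a<b) ∷ []

length-barelyRow : ∀ L a b R → length (barelyRow L a b R) ≡ length (L ++ a ∷ R)
length-barelyRow [] a b R = cong suc (length-singletons R)
length-barelyRow (x ∷ L) a b R = cong suc (length-barelyRow L a b R)

map-++-∷ : ∀ (X : List (List ℕ)) y Y → map length (X ++ y ∷ Y) ≡ map length X ++ length y ∷ map length Y
map-++-∷ [] y Y = refl
map-++-∷ (x ∷ X) y Y = cong (length x ∷_) (map-++-∷ X y Y)

shape-barely : ∀ A L a b R B → map length (barely A L a b R B) ≡ map length (A ++ (L ++ a ∷ R) ∷ B)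
shape-barely [] L a b R B = cong₂ _∷_ (length-barelyRow L a b R) (shape-singletons B)
shape-barely (X ∷ A) L a b R B = cong₂ _∷_ (length-singletons X) (shape-barely A L a b R B)

others-singleton : ∀ X Lc s Rc Y →
  (∀ r c s' → cell (X ++ (Lc ++ s ∷ Rc) ∷ Y) r c ≡ just s' → (r , c) ≢ (suc (length X) , suc (length Lc)) → length s' ≡ 1) →
  All (All Singleton) X × All Singleton Lc × All Singleton Rc × All (All Singleton) Y
others-singleton X Lc s Rc Y others =
  at-All X (λ r row e → at-All row (λ c s' e' →
    others r c s' (cell-intro T r c (at-++ˡ X (ρ ∷ Y) r e) e')
      (λ eq → <-irrefl refl (subst (_≤ length X) (cong proj₁ eq) (at⇒≤length X r e))))) ,
  at-All Lc (λ c s' e' →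
    others (suc (length X)) c s' (cell-intro T _ c (at-middle X ρ Y) (at-++ˡ Lc (s ∷ Rc) c e'))
      (λ eq → <-irrefl refl (subst (_≤ length Lc) (cong proj₂ eq) (at⇒≤length Lc c e')))) ,
  at-All′ Rc (λ i s' e' →
    others (suc (length X)) (suc (length Lc) + suc i) s' (cell-intro T _ _ (at-middle X ρ Y) (at-++ʳ Lc s Rc i e'))
      (λ eq → n≢n+suc (suc (length Lc)) i (sym (cong proj₂ eq)))) ,
  at-All′ Y (λ i row e → at-All row (λ c s' e' →
    others (suc (length X) + suc i) c s' (cell-intro T _ c (at-++ʳ X ρ Y i e) e')
      (λ eq → n≢n+suc (suc (length X)) i (sym (cong proj₁ eq)))))
  where
  ρ = Lc ++ s ∷ Rc
  T = X ++ ρ ∷ Y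

barely-decompose : ∀ T i0 c0 s → cell T i0 c0 ≡ just s → length s ≡ 2 →
  (∀ r c s → cell T r c ≡ just s → (r , c) ≢ (i0 , c0) → length s ≡ 1) →
  Σ (List (List ℕ)) λ A → Σ (List ℕ) λ L → Σ ℕ λ a → Σ ℕ λ b → Σ (List ℕ) λ R → Σ (List (List ℕ)) λ B →
    T ≡ barely A L a b R B
barely-decompose T i0 c0 (a ∷ b ∷ []) at-x0 refl others with cell-split T i0 c0 at-x0
... | row , e1 , e2 with at-split T i0 e1 | at-split row c0 e2
... | X , Y , refl , refl | Lc , Rc , refl , refl with others-singleton X Lc (a ∷ b ∷ []) Rc Y others
... | sX , sLc , sRc , sY =
  map (map headOr) X , map headOr Lc , a , b , map headOr Rc , map (map headOr) Y ,
  trans (cong (λ V → X ++ (Lc ++ (a ∷ b ∷ []) ∷ Rc) ∷ V) (singletonRows-headOr Y sY))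
        (cong₂ (λ U V → U ++ V ∷ map singletons (map (map headOr) Y)) (singletonRows-headOr X sX)
               (cong₂ (λ U V → U ++ (a ∷ b ∷ []) ∷ V) (singletons-headOr Lc sLc) (singletons-headOr Rc sRc)))

barely-cell : ∀ A L a b R B → cell (barely A L a b R B) (suc (length A)) (suc (length L)) ≡ just (a ∷ b ∷ [])
barely-cell A L a b R B = cell-intro (barely A L a b R B) _ _
  (subst (λ n → at (barely A L a b R B) (suc n) ≡ just (barelyRow L a b R)) (length-map singletons A)
     (at-middle (map singletons A) (barelyRow L a b R) (map singletons B)))
  (subst (λ n → at (barelyRow L a b R) (suc n) ≡ just (a ∷ b ∷ [])) (length-map [_] L)
     (at-middle (singletons L) (a ∷ b ∷ []) (singletons R)))

barely-others-singleton : ∀ A L a b R B r c s → cell (barely A L a b R B) r c ≡ just s →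
  (r , c) ≢ (suc (length A) , suc (length L)) → length s ≡ 1
barely-others-singleton A L a b R B r c s ec ne with cell-split (barely A L a b R B) r c ec
... | row , e1 , e2 with at-++-∷-cases (map singletons A) (barelyRow L a b R) (map singletons B) r e1
... | inj₁ e = All-at c (All-at r (singletonRows-singleton A) e) e2
... | inj₂ (inj₂ (i , _ , e)) = All-at c (All-at (suc i) (singletonRows-singleton B) e) e2
... | inj₂ (inj₁ (er , refl)) with at-++-∷-cases (singletons L) (a ∷ b ∷ []) (singletons R) c e2
... | inj₁ e = All-at c (singletons-singleton L) e
... | inj₂ (inj₂ (i , _ , e)) = All-at (suc i) (singletons-singleton R) e
... | inj₂ (inj₁ (ec' , _)) =
  ⊥-elim (ne (cong₂ _,_ (trans er (cong suc (length-map singletons A))) (trans ec' (cong suc (length-map [_] L)))))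

Head-after : ∀ L b R → NonDecreasing (L ++ b ∷ R) → Head (b ≤_) R
Head-after [] b R i = Linked-head i
Head-after (x ∷ L) b R i = Head-after L b R (Linked-tail i)

barelyRow-injective : ∀ L L' a a' b R R' → L ++ a ∷ R ≡ L' ++ a' ∷ R' → NonDecreasing (L ++ a ∷ R) →
  a < b → Head (b ≤_) R → a' < b → Head (b ≤_) R' → L ≡ L' × a ≡ a' × R ≡ R'
barelyRow-injective [] [] a a' b R R' e i ab hb ab' hb' = refl , proj₁ (∷-injective e) , proj₂ (∷-injective e)
barelyRow-injective [] (x ∷ L') a a' b R R' e i ab hb ab' hb' with proj₂ (∷-injective e)
... | refl = ⊥-elim (<-irrefl refl (<-≤-trans ab' (Head-≤-Head L' a' R' hb (Head-≤-middle L' a' R' (Linked-tail i)))))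
barelyRow-injective (x ∷ L) [] a a' b R R' e i ab hb ab' hb' with proj₂ (∷-injective e)
... | refl = ⊥-elim (<-irrefl refl (<-≤-trans ab (Head-≤-Head L a R hb' (Head-≤-middle L a R (Linked-tail i)))))
barelyRow-injective (x ∷ L) (x' ∷ L') a a' b R R' e i ab hb ab' hb'
  with barelyRow-injective L L' a a' b R R' (proj₂ (∷-injective e)) (Linked-tail i) ab hb ab' hb'
... | e1 , e2 , e3 = cong₂ _∷_ (proj₁ (∷-injective e)) e1 , e2 , e3

secondInRow-singletons : ∀ r → secondInRow (singletons r) ≡ nothing
secondInRow-singletons [] = refl
secondInRow-singletons (x ∷ r) = secondInRow-singletons r

headOr-singletons : ∀ r → map headOr (singletons r) ≡ r
headOr-singletons [] = refl
headOr-singletons (x ∷ r) = cong (x ∷_) (headOr-singletons r)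

headOr-singletonRows : ∀ B → map (map headOr) (map singletons B) ≡ B
headOr-singletonRows [] = refl
headOr-singletonRows (r ∷ B) = cong₂ _∷_ (headOr-singletons r) (headOr-singletonRows B)

secondInRow-barelyRow : ∀ L a b R → secondInRow (barelyRow L a b R) ≡ just b
secondInRow-barelyRow [] a b R = refl
secondInRow-barelyRow (x ∷ L) a b R = secondInRow-barelyRow L a b R

headOr-barelyRow : ∀ L a b R → map headOr (barelyRow L a b R) ≡ L ++ a ∷ R
headOr-barelyRow [] a b R = cong (a ∷_) (headOr-singletons R)
headOr-barelyRow (x ∷ L) a b R = cong (x ∷_) (headOr-barelyRow L a b R)

-- Uncrowding

-- T⁺ for T = barely A L a b R B.
uncrowded : List (List ℕ) → List ℕ → ℕ → ℕ → List ℕ → List (List ℕ) → List (List ℕ)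
uncrowded A L a b R B = A ++ (L ++ a ∷ R) ∷ insertRows b B

uncrowdRows-barely : ∀ A L a b R B i →
  uncrowdRows (barely A L a b R B) i ≡ (uncrowded A L a b R B , length A + i)
uncrowdRows-barely [] L a b R B i
  rewrite secondInRow-barelyRow L a b R | headOr-barelyRow L a b R | headOr-singletonRows B = refl
uncrowdRows-barely (X ∷ A) L a b R B i
  rewrite secondInRow-singletons X | uncrowdRows-barely A L a b R B (suc i) | headOr-singletons X | +-suc (length A) i = refl

uncrowd-barely : ∀ {lam A L a b R B n c} → CellAdded lam (map length (uncrowded A L a b R B)) n c →
  uncrowd lam (barely A L a b R B) ≡ (uncrowded A L a b R B , (n , c) , suc (length A))
uncrowd-barely {A = A} {L} {a} {b} {R} {B} {n} added
  rewrite uncrowdRows-barely A L a b R B 1 | newCell-cellAdded₁ added | +-comm (length A) 1 = refl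

semistandard⇒columnStrict : ∀ U → Semistandard U → ColumnStrictTableau (map length U) U
semistandard⇒columnStrict U sst =
  subst (λ m → SetValuedTableau m (map singletons U)) (shape-singletons U) (localSVT⇒svt _ (semistandard⇒localSVT U sst))

columnStrict⇒semistandard : ∀ U → Partition (map length U) → ColumnStrictTableau (map length U) U →
  Semistandard U
columnStrict⇒semistandard U part cst = localSVT⇒semistandard U (svt⇒localSVT (map singletons U) (map length U) part cst)

barelySetValued-view : ∀ lam T → Partition lam → BarelySetValued lam T →
  Σ (List (List ℕ)) λ A → Σ (List ℕ) λ L → Σ ℕ λ a → Σ ℕ λ b → Σ (List ℕ) λ R → Σ (List (List ℕ)) λ B →
    T ≡ barely A L a b R B × BarelyValid A L a b R B × map length (A ++ (L ++ a ∷ R) ∷ B) ≡ lam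
barelySetValued-view lam T part (svt , (i0 , c0) , (s , at-x0 , two) , others) with barely-decompose T i0 c0 s at-x0 two others
... | A , L , a , b , R , B , refl =
  A , L , a , b , R , B , refl , localSVT⇒barelyValid A L a b R B (svt⇒localSVT _ lam part svt) ,
  trans (sym (shape-barely A L a b R B)) (proj₁ svt)

row-with-a : ∀ {A L a b R B} → BarelyValid A L a b R B → NonDecreasing (L ++ a ∷ R)
row-with-a {A} {L} {a} {b} {R} {B} bd =
  proj₁ (proj₂ (All-split A _ B (Semistandard.rows-nonDecreasing (BarelyValid.with-a bd))))

after-b : ∀ {A L a b R B} → BarelyValid A L a b R B → Head (b ≤_) R
after-b {L = L} {b = b} {R} bd = Head-after L b R (BarelyValid.row-with-b bd)

record Uncrowding (lam : List ℕ) (A : List (List ℕ)) (L : List ℕ) (a b : ℕ) (R : List ℕ) (B : List (List ℕ)) : Set where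
  constructor uncrowding
  field
    k c : ℕ
    k-positive : 1 ≤ k
    shape : CellAdded lam (map length (uncrowded A L a b R B)) (suc (length A) + k) c
    recovers : uninsertRows k (insertRows b B) ≡ (b , B)
    uncrowded-semistandard : Semistandard (uncrowded A L a b R B)
    uncrowded-partition : Partition (map length (uncrowded A L a b R B))

uncrowd-forward : ∀ lam A L a b R B → Partition lam → BarelyValid A L a b R B →
  map length (A ++ (L ++ a ∷ R) ∷ B) ≡ lam → Uncrowding lam A L a b R B
uncrowd-forward lam A L a b R B (lam-positive , _) (barelyValid (semistandard aP aI lAρB) a<b iρb lρbB) refl
  with All-split A (L ++ a ∷ R) B aP | All-split A (L ++ a ∷ R) B aI
... | pA , pρ , pB | iA , iρ , iB
  with insertRow-splits L a b R (≤-middle L a R iρ) a<b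
... | a-bumps-b with insertRows-semistandard B (L ++ b ∷ R) a b iρb iB lρbB (cong proj₁ a-bumps-b)
... | iB' , lρbB' with All-split (map length A) _ (map length B) (subst (All (1 ≤_)) (map-++-∷ A (L ++ a ∷ R) B) lam-positive)
... | _ , _ , posB with uninsertRows-insertRows b B iB (positive⇒nonEmpty B posB)
... | k , c , added , recovers with cellAdded-row-suc added
... | k' , refl =
  uncrowding k c (s≤s z≤n) shape recovers sst
    (cellAdded-positive shape lam-positive , Linked⇒AllPairs (flip ≤-trans) (shape-nonincreasing U columns))
  where
  ρ = L ++ a ∷ R
  U = uncrowded A L a b R B
  lρB : Linked StrictlyAtop (ρ ∷ insertRows b B)
  lρB = subst (λ Z → Linked StrictlyAtop (Z ∷ insertRows b B)) (cong proj₂ a-bumps-b) lρbB'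
  columns : Linked StrictlyAtop U
  columns = Linked-splice A ρ B (insertRows b B) lAρB lρB
  sst : Semistandard U
  sst = semistandard (All-join pA pρ (positive-downward ρ (insertRows b B) lρB pρ)) (All-join iA iρ iB') columns
  shape : CellAdded (map length (A ++ ρ ∷ B)) (map length U) (suc (length A) + k) c
  shape = subst₂ (λ l m → CellAdded l m (suc (length A) + k) c)
            (sym (map-++-∷ A ρ B)) (sym (map-++-∷ A ρ (insertRows b B))) (cellAdded-prefix A ρ added)

uncrowd-target : ∀ lam → Partition lam → (T : List (List (List ℕ))) → BarelySetValued lam T →
  Target lam (uncrowd lam T)
uncrowd-target lam part T bsv with barelySetValued-view lam T part bsv
... | A , L , a , b , R , B , refl , bd , shape with uncrowd-forward lam A L a b R B part bd shape
... | uncrowding (suc j) c _ added _ sst partition =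
  subst (Target lam) (sym (uncrowd-barely added))
    (semistandard⇒columnStrict _ sst , cellAdded⇒covers added partition , s≤s z≤n , m<m+n (length A) (s≤s z≤n))

uncrowd-injective : ∀ lam → Partition lam → (T T' : List (List (List ℕ))) → BarelySetValued lam T →
  BarelySetValued lam T' →
  uncrowd lam T ≡ uncrowd lam T' → T ≡ T'
uncrowd-injective lam part T T' bsv bsv' same
  with barelySetValued-view lam T part bsv | barelySetValued-view lam T' part bsv'
... | A , L , a , b , R , B , refl , bd , shape | A' , L' , a' , b' , R' , B' , refl , bd' , shape'
  with uncrowd-forward lam A L a b R B part bd shape | uncrowd-forward lam A' L' a' b' R' B' part bd' shape'
... | uncrowding k c _ added recovers _ _ | uncrowding k' c' _ added' recovers' _ _
  with trans (sym (uncrowd-barely added)) (trans same (uncrowd-barely added'))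
... | same′ with ++-∷-cancel A A' (L ++ a ∷ R) (L' ++ a' ∷ R') (insertRows b B) (insertRows b' B')
                   (suc-injective (cong (proj₂ ∘ proj₂) same′)) (cong proj₁ same′)
... | refl , same-row , same-below with +-cancelˡ-≡ (suc (length A)) k k' (cong (proj₁ ∘ proj₁ ∘ proj₂) same′)
... | refl with trans (sym recovers) (trans (cong (uninsertRows k) same-below) recovers')
... | refl with barelyRow-injective L L' a a' b R R' same-row (row-with-a bd) (BarelyValid.a<b bd) (after-b bd)
                                                         (BarelyValid.a<b bd') (after-b bd')
... | refl , refl , refl = refl

barelyValid-fromUninsertion : ∀ {A L a v R B Q k c} → Semistandard (A ++ (L ++ a ∷ R) ∷ Q) →
  Uninsertion v B Q (L ++ a ∷ R) k c → unbumpRow v (L ++ a ∷ R) ≡ L ++ v ∷ R → a < v → BarelyValid A L a v R B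
barelyValid-fromUninsertion {A} {L} {a} {v} {R} {B} {Q} (semistandard positive rows columns)
  (uninsertion _ row-with-v rowsB columns-v _ _ _) unbumps a<v
  with All-split A (L ++ a ∷ R) Q positive | All-split A (L ++ a ∷ R) Q rows
... | pA , pρ , _ | rA , rρ , _ =
  barelyValid
    (semistandard (All-join pA pρ (positive-downward (L ++ v ∷ R) B below pρv)) (All-join rA rρ rowsB)
                  (Linked-splice A (L ++ a ∷ R) Q B columns
                     (Linked-replaceHead below (Head-map (λ {Y} → BarelyRow.atop-lower {a} {v} {R} a<v L Y) B))))
    a<v (subst NonDecreasing unbumps row-with-v) below
  where
  below : Linked StrictlyAtop ((L ++ v ∷ R) ∷ B)
  below = subst (λ Z → Linked StrictlyAtop (Z ∷ B)) unbumps columns-v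
  pρv : All (1 ≤_) (L ++ v ∷ R)
  pρv with All-split L a R pρ
  ... | pL , pa , pR = All-join pL (≤-trans pa (<⇒≤ a<v)) pR

barely-preimage : ∀ lam A ρ Q j c → Partition lam → Semistandard (A ++ ρ ∷ Q) →
  CellAdded lam (map length (A ++ ρ ∷ Q)) (suc (length A) + suc j) c →
  Σ (List (List (List ℕ))) λ T → BarelySetValued lam T × uncrowd lam T ≡ (A ++ ρ ∷ Q , (suc (length A) + suc j , c) , suc (length A))
barely-preimage lam A ρ Q j c (lam-positive , decreasing) sst added
  with cellAdded-split A ρ Q (subst (λ m → CellAdded lam m _ c) (map-++-∷ A ρ Q) added)
... | lamB , refl , addedB
  with AllPairs-suffix (map length A) decreasing | All-split (map length A) (length ρ) lamB lam-positive
... | _ ∷ decreasingB | _ , _ , positiveB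
  with All-split (map length A) (length ρ) (map length Q)
         (subst (All (1 ≤_)) (map-++-∷ A ρ Q) (cellAdded-positive added lam-positive))
... | _ , _ , positiveQ with All-split A ρ Q (Semistandard.rows-nonDecreasing sst)
... | _ , rρ , rQ
  with uninsertRows-correct (suc j) Q ρ lamB c addedB (AllPairs⇒Linked decreasingB) (positive⇒nonEmpty Q positiveQ) rρ rQ
         (Linked-suffix A ρ Q (Semistandard.columns-strict sst))
... | u with unbump-splits′ (proj₁ (uninsertRows (suc j) Q)) ρ rρ (Uninsertion.expelled-fits u)
... | L , a , R , refl , unbumps , a<v = barely A L a v R B , bsv , uncrowds
  where
  v = proj₁ (uninsertRows (suc j) Q)
  B = proj₂ (uninsertRows (suc j) Q)
  shapeB : map length B ≡ lamB
  shapeB = cellAdded-base-unique (Uninsertion.shape u) addedB (nonEmpty⇒positive B (Uninsertion.rows-nonEmpty u)) positiveB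
  shape : map length (barely A L a v R B) ≡ map length A ++ length (L ++ a ∷ R) ∷ lamB
  shape = trans (shape-barely A L a v R B)
            (trans (map-++-∷ A (L ++ a ∷ R) B) (cong (λ Z → map length A ++ length (L ++ a ∷ R) ∷ Z) shapeB))
  bsv : BarelySetValued _ (barely A L a v R B)
  bsv = subst (λ m → SetValuedTableau m (barely A L a v R B)) shape
          (localSVT⇒svt (barely A L a v R B)
             (barelyValid⇒localSVT A L a v R B (barelyValid-fromUninsertion sst u (cong proj₂ unbumps) a<v))) ,
        (suc (length A) , suc (length L)) , (a ∷ v ∷ [] , barely-cell A L a v R B , refl) , barely-others-singleton A L a v R B
  reinserted : uncrowded A L a v R B ≡ A ++ (L ++ a ∷ R) ∷ Q
  reinserted = cong (λ Z → A ++ (L ++ a ∷ R) ∷ Z) (Uninsertion.reinsert u)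
  uncrowds : uncrowd _ (barely A L a v R B) ≡ (A ++ (L ++ a ∷ R) ∷ Q , (suc (length A) + suc j , c) , suc (length A))
  uncrowds = trans (uncrowd-barely (subst (λ U → CellAdded _ (map length U) _ c) (sym reinserted) added))
                   (cong (λ U → U , (suc (length A) + suc j , c) , suc (length A)) reinserted)

row-exists : ∀ {lam} U {i c} i0 → CellAdded lam (map length U) i c → 1 ≤ i0 → i0 ≤ i ∸ 1 →
  Σ (List ℕ) λ ρ → at U i0 ≡ just ρ
row-exists U {i} i0 added 1≤i0 i0≤i∸1 =
  at-exists U i0 1≤i0 (≤-trans i0≤i∸1 (≤-trans (m∸n≤m i 1) (subst (i ≤_) (length-map length U) (cellAdded-row≤length added))))

uncrowd-surjective : ∀ lam → Partition lam → (t : List (List ℕ) × (ℕ × ℕ) × ℕ) → Target lam t →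
  Σ (List (List (List ℕ))) λ T → BarelySetValued lam T × uncrowd lam T ≡ t
uncrowd-surjective lam part (U , (i , c) , i0) (cst , cov , 1≤i0 , i0≤i∸1) with covers⇒cellAdded part cov
... | added with row-exists U i0 added 1≤i0 i0≤i∸1
... | ρ , at-i0 with at-split U i0 at-i0
... | A , Q , refl , refl with ≤∸1⇒+suc (suc (length A)) i (s≤s z≤n) i0≤i∸1
... | j , refl = barely-preimage lam A ρ Q j c part (columnStrict⇒semistandard _ (proj₁ cov) cst) added

proposition3p9 : (lam : List ℕ) → Partition lam →
    ((T : List (List (List ℕ))) → BarelySetValued lam T → Target lam (uncrowd lam T)) ×
    ((T T' : List (List (List ℕ))) → BarelySetValued lam T → BarelySetValued lam T' →
    uncrowd lam T ≡ uncrowd lam T' → T ≡ T') ×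
    ((t : List (List ℕ) × (ℕ × ℕ) × ℕ) → Target lam t →
    Σ (List (List (List ℕ))) λ T → BarelySetValued lam T × uncrowd lam T ≡ t)
proposition3p9 lam part = uncrowd-target lam part , uncrowd-injective lam part , uncrowd-surjective lam part
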